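{- For every $n\ge0$, $$P_n(t)=\sum_{\pi\in\mathcal S_n}t^{\mathrm{sch}(\pi)},\qquad Q_n(t)=\sum_{\pi\in\mathcal S^0_n}t^{\mathrm{sch}(\pi)},\qquad R_n(t)=\sum_{\pi\in\mathcal S^{00}_{n+1}}t^{\mathrm{sch}(\pi)}.$$
   Context: $P_n,Q_n,R_n$ are the polynomials with $\frac{d^n}{dx^n}\tan x=P_n(\tan x)$, $\frac{d^n}{dx^n}\sec x=Q_n(\tan x)\sec x$, $\frac{d^n}{dx^n}\sec^2x=R_n(\tan x)\sec^2x$. A signed permutation of size $n$ is a bijection $\pi$ of $\{ -n,\dots,-1,1,\dots,n\}$ with $\pi(-i)=-\pi(i)$, written $\pi_1\dots\pi_n$ with $\pi_i=\pi(i)$. A snake is a signed permutation with $\pi_1>\pi_2<\pi_3>\cdots\pi_n$ (alternating). $\mathcal S_n$ is the set of snakes of size $n$; $\mathcal S^0_n$ is the set of snakes with $\pi_1>0$; $\mathcal S^{00}_n$ is the set of snakes with $\pi_1>0$ and $(-1)^n\pi_n<0$. These three sets are regarded as distinct with different boundary conventions: for $\pi\in\mathcal S_n$ set $\pi_0=-(n+1)$, $\pi_{n+1}=(-1)^n(n+1)$; for $\pi\in\mathcal S^0_n$ set $\pi_0=0$, $\pi_{n+1}=(-1)^n(n+1)$; for $\pi\in\mathcal S^{00}_n$ set $\pi_0=\pi_{n+1}=0$. Then $\mathrm{sch}(\pi)=\#\{i: 0\le i\le n,\ \pi_i\pi_{i+1}<0\}$ is the number of sign changes in $\pi_0,\pi_1,\dots,\pi_{n+1}$.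 -}

module Defs where

open import Data.Bool using (Bool; true; false; not; _∧_; if_then_else_)
open import Data.Nat as ℕ using (ℕ; zero; suc; _*_)
open import Data.Nat.Base using (_≡ᵇ_)
open import Data.Integer as ℤ using (ℤ; +_; -_; ∣_∣; _≤ᵇ_; 0ℤ)
open import Data.List using (List; []; _∷_; [_]; map; concatMap; upTo; length; filterᵇ; _++_)
open import Data.Bool.ListAction using (any)

-- Polynomials with natural-number coefficients, as coefficient
-- sequences  p k = [t^k] p.

Poly : Set
Poly = ℕ → ℕ

deriv : Poly → Poly
deriv p k = suc k * p (suc k)

mulT : Poly → Poly
mulT p zero    = 0
mulT p (suc k) = p k

_⊕_ : Poly → Poly → Poly
(p ⊕ q) k = p k ℕ.+ q k

mul1+t² : Poly → Poly
mul1+t² p = p ⊕ mulT (mulT p)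

constP : ℕ → Poly
constP c zero    = c
constP c (suc k) = 0

tP : Poly
tP = mulT (constP 1)

-- d/dx P(tan x) = P'(tan x) (1 + tan² x),  tan x = P_0(tan x) with P_0 = t
P : ℕ → Poly
P zero    = tP
P (suc n) = mul1+t² (deriv (P n))

-- d/dx [Q(tan x) sec x] = [(1+tan² x) Q'(tan x) + tan x Q(tan x)] sec x
Q : ℕ → Poly
Q zero    = constP 1
Q (suc n) = mul1+t² (deriv (Q n)) ⊕ mulT (Q n)

-- d/dx [R(tan x) sec² x] = [(1+tan² x) R'(tan x) + 2 tan x R(tan x)] sec² x
R : ℕ → Poly
R zero    = constP 1
R (suc n) = mul1+t² (deriv (R n)) ⊕ mulT (R n ⊕ R n)

-- Signed permutations, written as the word  π₁ … πₙ  (a list of integers).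

_<ᵇ_ : ℤ → ℤ → Bool
x <ᵇ y = not (y ≤ᵇ x)

vals : ℕ → List ℤ
vals n = concatMap (λ i → + suc i ∷ - (+ suc i) ∷ []) (upTo n)

words : ℕ → List ℤ → List (List ℤ)
words zero    vs = [ [] ]
words (suc m) vs = concatMap (λ x → map (x ∷_) (words m vs)) vs

distinctᵇ : List ℕ → Bool
distinctᵇ []      = true
distinctᵇ (a ∷ l) = not (any (a ≡ᵇ_) l) ∧ distinctᵇ l

-- all signed permutations of size n: words π₁…πₙ with πᵢ ∈ {±1,…,±n}
-- and |π₁|,…,|πₙ| pairwise distinct (so i ↦ πᵢ, extended by
-- π(-i) = -π(i), is a bijection of {-n,…,-1,1,…,n}).
signedPerms : ℕ → List (List ℤ)
signedPerms n = filterᵇ (λ w → distinctᵇ (map ∣_∣ w)) (words n (vals n))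

altDown altUp : List ℤ → Bool
altDown (x ∷ y ∷ r) = (y <ᵇ x) ∧ altUp (y ∷ r)
altDown _           = true
altUp   (x ∷ y ∷ r) = (x <ᵇ y) ∧ altDown (y ∷ r)
altUp   _           = true

isSnake : List ℤ → Bool
isSnake = altDown

firstPos : List ℤ → Bool
firstPos []      = true
firstPos (x ∷ _) = 0ℤ <ᵇ x

lastOf : List ℤ → ℤ
lastOf []          = 0ℤ
lastOf (x ∷ [])    = x
lastOf (_ ∷ y ∷ r) = lastOf (y ∷ r)

signPow : ℕ → ℤ → ℤ
signPow zero          x = x
signPow (suc zero)    x = - x
signPow (suc (suc n)) x = signPow n x

snakes snakes0 snakes00 : ℕ → List (List ℤ)
snakes   n = filterᵇ isSnake (signedPerms n)
snakes0  n = filterᵇ (λ w → isSnake w ∧ firstPos w) (signedPerms n)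
snakes00 n = filterᵇ (λ w → isSnake w ∧ firstPos w ∧ (signPow n (lastOf w) <ᵇ 0ℤ))
                     (signedPerms n)

signChanges : List ℤ → ℕ
signChanges (x ∷ y ∷ r) =
  (if ℤ._*_ x y <ᵇ 0ℤ then 1 else 0) ℕ.+ signChanges (y ∷ r)
signChanges _ = 0

sch sch0 sch00 : ℕ → List ℤ → ℕ
sch   n w = signChanges ((- (+ suc n)) ∷ w ++ [ signPow n (+ suc n) ])
sch0  n w = signChanges (0ℤ ∷ w ++ [ signPow n (+ suc n) ])
sch00 n w = signChanges (0ℤ ∷ w ++ [ 0ℤ ])

genPoly : List (List ℤ) → (List ℤ → ℕ) → Poly
genPoly S f k = length (filterᵇ (λ w → f w ≡ᵇ k) S)

module Submission where

-- Write a snake π of size n together with its boundary values as the word e = π₀ π₁ ⋯ πₙ₊₁, a zigzag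
-- π₀ < π₁ > π₂ < ⋯.  Inserting a unit c = ±1 between neighbours a, b of e, while moving all other
-- entries one step away from 0 and negating those after c, gives a zigzag of size n + 1 exactly when
-- a, b are not both 0 and c continues the zigzag; conversely every snake of size n + 1 arises this way from
-- exactly one snake of size n, namely by deleting its entry of absolute value 1.  A pair a, b of opposite
-- signs admits both units and the results have sch(e) ∓ 1 sign changes; a pair with exactly one zero admits
-- one unit and yields sch(e) + 1; other pairs admit none.  So the snakes grown from e contribute
-- (1 + t²) d/dt t^sch(e) + z t ⋅ t^sch(e), where z ∈ {0, 1, 2} counts the zero boundary values, and these
-- are precisely the recurrences defining P, Q and R.

open import Data.Bool using (Bool; true; false; not; _∧_; if_then_else_; T)
open import Data.Bool.ListAction using (any)
open import Data.Bool.Properties using (∧-assoc; ∧-comm; ∧-identityʳ; T-∧; T-≡)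
open import Data.Empty using (⊥-elim)
open import Data.Integer as ℤ using (ℤ; +0; -_; ∣_∣; -[1+_]; +[1+_]; 0ℤ; 1ℤ; -1ℤ)
open import Data.Integer.Properties using (∣i∣≡0⇒i≡0; ∣-i∣≡∣i∣; neg-involutive)
open import Data.List using (List; []; _∷_; [_]; map; _++_; length; filter; filterᵇ; concatMap; upTo)
open import Data.List.Membership.Propositional using (_∈_; find; lose)
open import Data.List.Membership.Propositional.Properties
  using (∈-map⁺; ∈-map⁻; ∈-++⁺ˡ; ∈-++⁺ʳ; ∈-++⁻; ∈-concatMap⁺; ∈-concatMap⁻; ∈-upTo⁺; ∈-upTo⁻;
         ∈-filter⁺; ∈-filter⁻; ∈-∃++)
open import Data.List.Membership.Propositional.Properties.WithK using (unique∧set⇒bag)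
open import Data.List.Properties
  using (filter-++; length-++; length-++-sucʳ; length-map; map-++; ++-assoc; map-∘; map-id-local;
         ∷-injective; ∷-injectiveˡ; ∷-injectiveʳ; ∷ʳ-injectiveˡ)
open import Data.List.Relation.Binary.BagAndSetEquality using (∼bag⇒↭)
open import Data.List.Relation.Binary.Permutation.Propositional using (_↭_)
open import Data.List.Relation.Binary.Permutation.Propositional.Properties using (↭-length; filter-↭)
open import Data.List.Relation.Unary.All as All using (All; []; _∷_)
import Data.List.Relation.Unary.All.Properties as AllP
open import Data.List.Relation.Unary.AllPairs using ([]; _∷_)
open import Data.List.Relation.Unary.Any as Any using (Any; here; there)
open import Data.List.Relation.Unary.Unique.Propositional using (Unique)
import Data.List.Relation.Unary.Unique.Propositional.Properties as UP
open import Data.Nat as ℕ using (ℕ; zero; suc; _+_; _*_; _∸_; _≤_; _<_; z≤n; s≤s; _≡ᵇ_)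
open import Data.List.Membership.DecPropositional ℕ._≟_ using (_∈?_)
open import Data.Nat.Properties
  using (+-identityʳ; +-assoc; +-comm; *-zeroʳ; *-identityˡ; suc-injective; ≡ᵇ⇒≡; ≡⇒≡ᵇ; ≤-pred; ≤∧≢⇒<; n≮n;
         <⇒≱; ≤ᵇ⇒≤; m≤n⇒m≤1+n; module ≤-Reasoning)
open import Data.Nat.Tactic.RingSolver using (solve-∀)
open import Data.Product using (_×_; _,_; proj₁; proj₂; ∃; ∃₂)
open import Data.Sum as Sum using (_⊎_; inj₁; inj₂)
open import Function using (_∘_; const; case_of_; mk⇔; Equivalence)
open import Relation.Binary.PropositionalEquality hiding ([_])
open import Relation.Nullary using (¬_; yes; no)
open import Relation.Nullary.Decidable using (T?)

open import Defs

-- Coefficients of (1 + t²) p′ + z t p.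
D : ℕ → Poly → Poly
D z p zero    = p 1
D z p (suc k) = suc (suc k) * p (suc (suc k)) + k * p k + z * p k

monomial : ℕ → Poly
monomial j k = if j ≡ᵇ k then 1 else 0

D-cong : ∀ z {p q} → p ≗ q → D z p ≗ D z q
D-cong z p≗q zero    = p≗q 1
D-cong z p≗q (suc k) =
  cong₂ (λ a b → suc (suc k) * a + k * b + z * b) (p≗q (suc (suc k))) (p≗q k)

D-⊕ : ∀ z p q → D z (p ⊕ q) ≗ D z p ⊕ D z q
D-⊕ z p q zero    = refl
D-⊕ z p q (suc k) = distrib (suc (suc k)) k z (p (suc (suc k))) (q (suc (suc k))) (p k) (q k)
  where
  distrib : ∀ m k z a b c d →
            m * (a + b) + k * (c + d) + z * (c + d) ≡ (m * a + k * c + z * c) + (m * b + k * d + z * d)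
  distrib = solve-∀

D-leibniz : ∀ z p → D z (mulT p) ≗ mul1+t² p ⊕ mulT (D z p)
D-leibniz z p zero          = sym (trans (+-identityʳ _) (+-identityʳ _))
D-leibniz z p (suc zero)    = begin
  2 * p 1 + 0 + z * 0  ≡⟨ cong ((2 * p 1 + 0) +_) (*-zeroʳ z) ⟩
  2 * p 1 + 0 + 0      ≡⟨ double (p 1) ⟩
  p 1 + 0 + p 1        ∎
  where
  open ≡-Reasoning
  double : ∀ a → 2 * a + 0 + 0 ≡ a + 0 + a
  double = solve-∀
D-leibniz z p (suc (suc j)) = expand j z (p (suc (suc j))) (p j)
  where
  expand : ∀ j z a b → suc (suc (suc j)) * a + suc j * b + z * b ≡
                       (a + b) + (suc (suc j) * a + j * b + z * b)
  expand = solve-∀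

D-suc : ∀ z p → D (suc z) p ≗ D z p ⊕ mulT p
D-suc z p zero    = sym (+-identityʳ _)
D-suc z p (suc k) = shuffle (suc (suc k) * p (suc (suc k)) + k * p k) z (p k)
  where
  shuffle : ∀ a z b → a + (b + z * b) ≡ (a + z * b) + b
  shuffle = solve-∀

D-monomial₀ : D 0 (monomial 0) ≗ const 0
D-monomial₀ zero                            = refl
D-monomial₀ (suc zero)                      = refl
D-monomial₀ (suc (suc j)) rewrite *-zeroʳ j = refl

D-const0 : ∀ z → D z (const 0) ≗ const 0
D-const0 z zero    = refl
D-const0 z (suc k) rewrite *-zeroʳ k | *-zeroʳ z = refl

monomial-suc : ∀ j → monomial (suc j) ≗ mulT (monomial j)
monomial-suc j zero    = refl
monomial-suc j (suc k) = refl

mulT-cong : ∀ {p q} → p ≗ q → mulT p ≗ mulT q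
mulT-cong p≗q zero    = refl
mulT-cong p≗q (suc k) = p≗q k

⊕-cong : ∀ {p p′ q q′} → p ≗ p′ → q ≗ q′ → p ⊕ q ≗ p′ ⊕ q′
⊕-cong p≗p′ q≗q′ k = cong₂ _+_ (p≗p′ k) (q≗q′ k)

mul1+t²-deriv : ∀ p → mul1+t² (deriv p) ≗ D 0 p
mul1+t²-deriv p zero          = trans (+-identityʳ _) (*-identityˡ _)
mul1+t²-deriv p (suc zero)    = sym (+-identityʳ _)
mul1+t²-deriv p (suc (suc j)) = sym (+-identityʳ _)

mulT-⊕ : ∀ p q → mulT (p ⊕ q) ≗ mulT p ⊕ mulT q
mulT-⊕ p q zero    = refl
mulT-⊕ p q (suc k) = refl

P-recurrence : ∀ n → P (suc n) ≗ D 0 (P n)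
P-recurrence n = mul1+t²-deriv (P n)

Q-recurrence : ∀ n → Q (suc n) ≗ D 1 (Q n)
Q-recurrence n k = trans (cong (_+ mulT (Q n) k) (mul1+t²-deriv (Q n) k)) (sym (D-suc 0 (Q n) k))

R-recurrence : ∀ n → R (suc n) ≗ D 2 (R n)
R-recurrence n k = begin
  mul1+t² (deriv r) k + mulT (r ⊕ r) k       ≡⟨ cong₂ _+_ (mul1+t²-deriv r k) (mulT-⊕ r r k) ⟩
  D 0 r k + (mulT r k + mulT r k)           ≡⟨ sym (+-assoc (D 0 r k) _ _) ⟩
  D 0 r k + mulT r k + mulT r k             ≡⟨ cong (_+ mulT r k) (sym (D-suc 0 r k)) ⟩
  D 1 r k + mulT r k                        ≡⟨ sym (D-suc 1 r k) ⟩
  D 2 r k                                   ∎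
  where
  open ≡-Reasoning
  r : Poly
  r = R n

D-recurrence-unique : ∀ z (G H : ℕ → Poly) → G 0 ≗ H 0 →
  (∀ n → G (suc n) ≗ D z (G n)) → (∀ n → H (suc n) ≗ D z (H n)) → ∀ n → G n ≗ H n
D-recurrence-unique z G H G₀≗H₀ G-rec H-rec zero    = G₀≗H₀
D-recurrence-unique z G H G₀≗H₀ G-rec H-rec (suc n) k =
  trans (G-rec n k) (trans (D-cong z (D-recurrence-unique z G H G₀≗H₀ G-rec H-rec n) k) (sym (H-rec n k)))

genPoly-∷ : ∀ x L f k → genPoly (x ∷ L) f k ≡ monomial (f x) k + genPoly L f k
genPoly-∷ x L f k with f x ≡ᵇ k
... | true  = refl
... | false = refl

genPoly-++ : ∀ L M f → genPoly (L ++ M) f ≗ genPoly L f ⊕ genPoly M f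
genPoly-++ L M f k = trans (cong length (filter-++ _ L M)) (length-++ (filterᵇ _ L))

genPoly-map : ∀ (g : List ℤ → List ℤ) L f → genPoly (map g L) f ≗ genPoly L (f ∘ g)
genPoly-map g []      f k = refl
genPoly-map g (x ∷ L) f k = trans (genPoly-∷ (g x) (map g L) f k)
  (trans (cong (monomial (f (g x)) k +_) (genPoly-map g L f k)) (sym (genPoly-∷ x L (f ∘ g) k)))

genPoly-cong : ∀ L {f g} → (∀ x → f x ≡ g x) → genPoly L f ≗ genPoly L g
genPoly-cong []      f≗g k = refl
genPoly-cong (x ∷ L) {f} {g} f≗g k = trans (genPoly-∷ x L f k)
  (trans (cong₂ (λ j c → monomial j k + c) (f≗g x) (genPoly-cong L f≗g k)) (sym (genPoly-∷ x L g k)))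

genPoly-suc : ∀ L f → genPoly L (suc ∘ f) ≗ mulT (genPoly L f)
genPoly-suc []      f zero    = refl
genPoly-suc (x ∷ L) f zero    = genPoly-suc L f zero
genPoly-suc L       f (suc k) = refl

genPoly-single : ∀ f w j → f w ≡ j → genPoly [ w ] f ≗ monomial j
genPoly-single f w j fw≡j k = trans (genPoly-∷ w [] f k)
  (trans (+-identityʳ _) (cong (λ i → monomial i k) fw≡j))

genPoly-pair : ∀ f w₁ w₂ j → f w₁ ≡ j → f w₂ ≡ suc (suc (f w₁)) →
  genPoly (w₁ ∷ w₂ ∷ []) f ≗ mul1+t² (monomial j)
genPoly-pair f w₁ w₂ j fw₁≡j fw₂≡2+fw₁ k = begin
  genPoly (w₁ ∷ w₂ ∷ []) f k                        ≡⟨ genPoly-∷ w₁ _ f k ⟩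
  monomial (f w₁) k + genPoly [ w₂ ] f k            ≡⟨ cong₂ _+_ (cong (λ i → monomial i k) fw₁≡j)
                                                                 (genPoly-single f w₂ _ fw₂≡2+j k) ⟩
  monomial j k + monomial (suc (suc j)) k           ≡⟨ cong (monomial j k +_) (monomial-suc (suc j) k) ⟩
  monomial j k + mulT (monomial (suc j)) k          ≡⟨ cong (monomial j k +_) (mulT-cong (monomial-suc j) k) ⟩
  mul1+t² (monomial j) k                            ∎
  where
  open ≡-Reasoning
  fw₂≡2+j : f w₂ ≡ suc (suc j)
  fw₂≡2+j = trans fw₂≡2+fw₁ (cong (suc ∘ suc) fw₁≡j)

genPoly-prefix : ∀ x L f g → (∀ y → f (x ∷ y) ≡ g y) → genPoly (map (x ∷_) L) f ≗ genPoly L g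
genPoly-prefix x L f g f∷≗g k = trans (genPoly-map (x ∷_) L f k) (genPoly-cong L f∷≗g k)

genPoly-↭ : ∀ {L M} f → L ↭ M → genPoly L f ≗ genPoly M f
genPoly-↭ f L↭M k = ↭-length (filter-↭ _ L↭M)

genPoly-sameElements : ∀ {L M} f → Unique L → Unique M →
  (∀ {w} → w ∈ L → w ∈ M) → (∀ {w} → w ∈ M → w ∈ L) → genPoly L f ≗ genPoly M f
genPoly-sameElements f uL uM L⊆M M⊆L = genPoly-↭ f (∼bag⇒↭ (unique∧set⇒bag uL uM (mk⇔ L⊆M M⊆L)))

concatMap-unique : ∀ {A B : Set} (f : A → List B) (f⁻¹ : B → A) {L} → Unique L → (∀ a → Unique (f a)) →
  (∀ a b → b ∈ f a → f⁻¹ b ≡ a) → Unique (concatMap f L)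
concatMap-unique f f⁻¹ {[]}    _              _        _    = []
concatMap-unique f f⁻¹ {a ∷ L} (a∉L ∷ uniqL) uniqF inverse =
  UP.++⁺ (uniqF a) (concatMap-unique f f⁻¹ uniqL uniqF inverse) disjoint
  where
  disjoint : ∀ {b} → ¬ (b ∈ f a × b ∈ concatMap f L)
  disjoint (b∈fa , b∈rest) with find (∈-concatMap⁻ f {xs = L} b∈rest)
  ... | a′ , a′∈L , b∈fa′ = All.lookup a∉L a′∈L (trans (sym (inverse a _ b∈fa)) (inverse a′ _ b∈fa′))

Unique-insert : ∀ {A : Set} (xs ys : List A) z → Unique (xs ++ ys) →
  All (z ≢_) (xs ++ ys) → Unique (xs ++ z ∷ ys)
Unique-insert []       ys z uniq        z∉         = z∉ ∷ uniq
Unique-insert (x ∷ xs) ys z (x∉ ∷ uniq) (z≢x ∷ z∉) =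
  AllP.++⁺ (AllP.++⁻ˡ xs x∉) ((z≢x ∘ sym) ∷ AllP.++⁻ʳ xs x∉) ∷ Unique-insert xs ys z uniq z∉

Unique-remove : ∀ {A : Set} (xs ys : List A) z → Unique (xs ++ z ∷ ys) →
  Unique (xs ++ ys) × All (z ≢_) (xs ++ ys)
Unique-remove []       ys z (z∉ ∷ uniq) = uniq , z∉
Unique-remove (x ∷ xs) ys z (x∉ ∷ uniq) with Unique-remove xs ys z uniq | AllP.++⁻ xs x∉
... | uniq′ , z∉ | x∉xs , x≢z ∷ x∉ys = AllP.++⁺ x∉xs x∉ys ∷ uniq′ , (x≢z ∘ sym) ∷ z∉

unique-length-≤ : ∀ N xs → Unique xs → All (_< N) xs → length xs ≤ N
unique-length-≤ zero    []      _    _         = z≤n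
unique-length-≤ zero    (x ∷ _) _    (() ∷ _)
unique-length-≤ (suc N) xs      uniq xs<1+N with N ∈? xs
... | no N∉xs = m≤n⇒m≤1+n (unique-length-≤ N xs uniq
                  (All.zipWith (λ (x<1+N , N≢x) → ≤∧≢⇒< (≤-pred x<1+N) (N≢x ∘ sym))
                               (xs<1+N , AllP.¬Any⇒All¬ xs N∉xs)))
... | yes N∈xs with ∈-∃++ N∈xs
...   | ys , zs , refl with Unique-remove ys zs N uniq | AllP.++⁻ ys xs<1+N
...     | uniq′ , N≢ | ys<1+N , _ ∷ zs<1+N = begin
  length (ys ++ N ∷ zs)   ≡⟨ length-++-sucʳ ys N zs ⟩
  suc (length (ys ++ zs)) ≤⟨ s≤s (unique-length-≤ N (ys ++ zs) uniq′ ys++zs<N) ⟩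
  suc N                   ∎
  where
  open ≤-Reasoning
  ys++zs<N : All (_< N) (ys ++ zs)
  ys++zs<N = All.zipWith (λ (x<1+N , N≢x) → ≤∧≢⇒< (≤-pred x<1+N) (N≢x ∘ sym)) (AllP.++⁺ ys<1+N zs<1+N , N≢)

shift : ℤ → ℤ
shift +[1+ m ] = +[1+ suc m ]
shift -[1+ m ] = -[1+ suc m ]
shift +0       = 0ℤ

negShift : ℤ → ℤ
negShift x = - shift x

-- Left inverse of shift; the units ±1 are sent to 0 (junk).
unshift : ℤ → ℤ
unshift +[1+ suc m ] = +[1+ m ]
unshift -[1+ suc m ] = -[1+ m ]
unshift _            = 0ℤ

unnegShift : ℤ → ℤ
unnegShift x = unshift (- x)

unshift-shift : ∀ x → unshift (shift x) ≡ x
unshift-shift +[1+ m ] = refl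
unshift-shift -[1+ m ] = refl
unshift-shift +0       = refl

unnegShift-negShift : ∀ x → unnegShift (negShift x) ≡ x
unnegShift-negShift +[1+ m ] = refl
unnegShift-negShift -[1+ m ] = refl
unnegShift-negShift +0       = refl

shift-unshift : ∀ x → ∣ x ∣ ≢ 1 → shift (unshift x) ≡ x
shift-unshift +[1+ suc m ] _  = refl
shift-unshift -[1+ suc m ] _  = refl
shift-unshift +0           _  = refl
shift-unshift +[1+ zero ]  ≢1 = ⊥-elim (≢1 refl)
shift-unshift -[1+ zero ]  ≢1 = ⊥-elim (≢1 refl)

negShift-unnegShift : ∀ x → ∣ x ∣ ≢ 1 → negShift (unnegShift x) ≡ x
negShift-unnegShift +[1+ suc m ] _  = refl
negShift-unnegShift -[1+ suc m ] _  = refl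
negShift-unnegShift +0           _  = refl
negShift-unnegShift +[1+ zero ]  ≢1 = ⊥-elim (≢1 refl)
negShift-unnegShift -[1+ zero ]  ≢1 = ⊥-elim (≢1 refl)

shiftℕ : ℕ → ℕ
shiftℕ zero    = zero
shiftℕ (suc m) = suc (suc m)

shiftℕ-injective : ∀ {a b} → shiftℕ a ≡ shiftℕ b → a ≡ b
shiftℕ-injective {zero}  {zero}  _    = refl
shiftℕ-injective {suc a} {suc b} refl = refl

shiftℕ≢1 : ∀ a → shiftℕ a ≢ 1
shiftℕ≢1 zero    ()
shiftℕ≢1 (suc a) ()

∣shift∣ : ∀ x → ∣ shift x ∣ ≡ shiftℕ ∣ x ∣
∣shift∣ +[1+ m ] = refl
∣shift∣ -[1+ m ] = refl
∣shift∣ +0       = refl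

∣negShift∣ : ∀ x → ∣ negShift x ∣ ≡ shiftℕ ∣ x ∣
∣negShift∣ +[1+ m ] = refl
∣negShift∣ -[1+ m ] = refl
∣negShift∣ +0       = refl

shift-nonUnit : ∀ x → ∣ shift x ∣ ≢ 1
shift-nonUnit x = shiftℕ≢1 ∣ x ∣ ∘ trans (sym (∣shift∣ x))

<ᵇ-suc : ∀ m n → (m ℕ.<ᵇ suc n) ≡ (m ℕ.≤ᵇ n)
<ᵇ-suc zero    n = refl
<ᵇ-suc (suc m) n = refl

≤ᵇ-shift : ∀ x y → (shift x ℤ.≤ᵇ shift y) ≡ (x ℤ.≤ᵇ y)
≤ᵇ-shift +0       +0       = refl
≤ᵇ-shift +0       +[1+ n ] = refl
≤ᵇ-shift +0       -[1+ n ] = refl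
≤ᵇ-shift +[1+ m ] +0       = refl
≤ᵇ-shift +[1+ m ] +[1+ n ] = refl
≤ᵇ-shift +[1+ m ] -[1+ n ] = refl
≤ᵇ-shift -[1+ m ] +0       = refl
≤ᵇ-shift -[1+ m ] +[1+ n ] = refl
≤ᵇ-shift -[1+ m ] -[1+ n ] = <ᵇ-suc n m

≤ᵇ-neg : ∀ x y → (- x ℤ.≤ᵇ - y) ≡ (y ℤ.≤ᵇ x)
≤ᵇ-neg +0       +0       = refl
≤ᵇ-neg +0       +[1+ n ] = refl
≤ᵇ-neg +0       -[1+ n ] = refl
≤ᵇ-neg +[1+ m ] +0       = refl
≤ᵇ-neg +[1+ m ] +[1+ n ] = sym (<ᵇ-suc n m)
≤ᵇ-neg +[1+ m ] -[1+ n ] = refl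
≤ᵇ-neg -[1+ m ] +0       = refl
≤ᵇ-neg -[1+ m ] +[1+ n ] = refl
≤ᵇ-neg -[1+ m ] -[1+ n ] = <ᵇ-suc m n

<ᵇ-shift : ∀ x y → (shift x <ᵇ shift y) ≡ (x <ᵇ y)
<ᵇ-shift x y = cong not (≤ᵇ-shift y x)

<ᵇ-neg : ∀ x y → ((- x) <ᵇ (- y)) ≡ (y <ᵇ x)
<ᵇ-neg x y = cong not (≤ᵇ-neg y x)

step : Bool → ℤ → ℤ → Bool
step true  x y = x <ᵇ y
step false x y = y <ᵇ x

zigzag : Bool → List ℤ → Bool
zigzag d (x ∷ y ∷ r) = step d x y ∧ zigzag (not d) (y ∷ r)
zigzag d _           = true

altUp≡zigzag : ∀ l → altUp l ≡ zigzag true l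
altDown≡zigzag : ∀ l → altDown l ≡ zigzag false l
altUp≡zigzag []          = refl
altUp≡zigzag (x ∷ [])    = refl
altUp≡zigzag (x ∷ y ∷ r) = cong ((x <ᵇ y) ∧_) (altDown≡zigzag (y ∷ r))
altDown≡zigzag []          = refl
altDown≡zigzag (x ∷ [])    = refl
altDown≡zigzag (x ∷ y ∷ r) = cong ((y <ᵇ x) ∧_) (altUp≡zigzag (y ∷ r))

step-shift : ∀ d x y → step d (shift x) (shift y) ≡ step d x y
step-shift true  x y = <ᵇ-shift x y
step-shift false x y = <ᵇ-shift y x

step-negShift : ∀ d x y → step d (negShift x) (negShift y) ≡ step (not d) x y
step-negShift true  x y = trans (<ᵇ-neg (shift x) (shift y)) (<ᵇ-shift y x)
step-negShift false x y = trans (<ᵇ-neg (shift y) (shift x)) (<ᵇ-shift x y)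

zigzag-shift : ∀ d l → zigzag d (map shift l) ≡ zigzag d l
zigzag-shift d []          = refl
zigzag-shift d (x ∷ [])    = refl
zigzag-shift d (x ∷ y ∷ r) = cong₂ _∧_ (step-shift d x y) (zigzag-shift (not d) (y ∷ r))

zigzag-negShift : ∀ d l → zigzag d (map negShift l) ≡ zigzag (not d) l
zigzag-negShift d []          = refl
zigzag-negShift d (x ∷ [])    = refl
zigzag-negShift d (x ∷ y ∷ r) = cong₂ _∧_ (step-negShift d x y) (zigzag-negShift (not d) (y ∷ r))

flips : ℕ → Bool → Bool
flips zero    d = d
flips (suc m) d = flips m (not d)

zigzag-++ : ∀ d xs y ys →
  zigzag d (xs ++ y ∷ ys) ≡ zigzag d (xs ++ [ y ]) ∧ zigzag (flips (length xs) d) (y ∷ ys)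
zigzag-++ d []            y ys = refl
zigzag-++ d (x ∷ [])      y ys = cong (_∧ zigzag (not d) (y ∷ ys)) (sym (∧-identityʳ (step d x y)))
zigzag-++ d (x ∷ x′ ∷ xs) y ys =
  trans (cong (step d x x′ ∧_) (zigzag-++ (not d) (x′ ∷ xs) y ys)) (sym (∧-assoc (step d x x′) _ _))

countAdjacent : (ℤ → ℤ → Bool) → List ℤ → ℕ
countAdjacent p (x ∷ y ∷ r) = (if p x y then 1 else 0) + countAdjacent p (y ∷ r)
countAdjacent p _           = 0

countAdjacent-map : ∀ p f → (∀ x y → p (f x) (f y) ≡ p x y) →
  ∀ l → countAdjacent p (map f l) ≡ countAdjacent p l
countAdjacent-map p f pf≡p []          = refl
countAdjacent-map p f pf≡p (x ∷ [])    = refl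
countAdjacent-map p f pf≡p (x ∷ y ∷ r) =
  cong₂ (λ b n → (if b then 1 else 0) + n) (pf≡p x y) (countAdjacent-map p f pf≡p (y ∷ r))

opposite : ℤ → ℤ → Bool
opposite +[1+ m ] -[1+ n ] = true
opposite -[1+ m ] +[1+ n ] = true
opposite _        _        = false

oneZero : ℤ → ℤ → Bool
oneZero +0       +[1+ n ] = true
oneZero +0       -[1+ n ] = true
oneZero +[1+ m ] +0       = true
oneZero -[1+ m ] +0       = true
oneZero _        _        = false

crossings zeroContacts : List ℤ → ℕ
crossings    = countAdjacent opposite
zeroContacts = countAdjacent oneZero

*<ᵇ0≡opposite : ∀ x y → ((x ℤ.* y) <ᵇ 0ℤ) ≡ opposite x y
*<ᵇ0≡opposite +0       +0       = refl
*<ᵇ0≡opposite +0       +[1+ n ] = refl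
*<ᵇ0≡opposite +0       -[1+ n ] = refl
*<ᵇ0≡opposite +[1+ m ] +0       rewrite *-zeroʳ m = refl
*<ᵇ0≡opposite +[1+ m ] +[1+ n ] = refl
*<ᵇ0≡opposite +[1+ m ] -[1+ n ] = refl
*<ᵇ0≡opposite -[1+ m ] +0       rewrite *-zeroʳ m = refl
*<ᵇ0≡opposite -[1+ m ] +[1+ n ] = refl
*<ᵇ0≡opposite -[1+ m ] -[1+ n ] = refl

signChanges≡crossings : ∀ l → signChanges l ≡ crossings l
signChanges≡crossings []          = refl
signChanges≡crossings (x ∷ [])    = refl
signChanges≡crossings (x ∷ y ∷ r) =
  cong₂ (λ b n → (if b then 1 else 0) + n) (*<ᵇ0≡opposite x y) (signChanges≡crossings (y ∷ r))

opposite-shift : ∀ x y → opposite (shift x) (shift y) ≡ opposite x y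
opposite-shift +0       +0       = refl
opposite-shift +0       +[1+ n ] = refl
opposite-shift +0       -[1+ n ] = refl
opposite-shift +[1+ m ] +0       = refl
opposite-shift +[1+ m ] +[1+ n ] = refl
opposite-shift +[1+ m ] -[1+ n ] = refl
opposite-shift -[1+ m ] +0       = refl
opposite-shift -[1+ m ] +[1+ n ] = refl
opposite-shift -[1+ m ] -[1+ n ] = refl

opposite-negShift : ∀ x y → opposite (negShift x) (negShift y) ≡ opposite x y
opposite-negShift +0       +0       = refl
opposite-negShift +0       +[1+ n ] = refl
opposite-negShift +0       -[1+ n ] = refl
opposite-negShift +[1+ m ] +0       = refl
opposite-negShift +[1+ m ] +[1+ n ] = refl
opposite-negShift +[1+ m ] -[1+ n ] = refl
opposite-negShift -[1+ m ] +0       = refl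
opposite-negShift -[1+ m ] +[1+ n ] = refl
opposite-negShift -[1+ m ] -[1+ n ] = refl

crossings-negShift : ∀ l → crossings (map negShift l) ≡ crossings l
crossings-negShift = countAdjacent-map opposite negShift opposite-negShift

isZero : ℤ → ℕ
isZero +0 = 1
isZero _  = 0

isZero-nonzero : ∀ x → x ≢ 0ℤ → isZero x ≡ 0
isZero-nonzero +0       x≢0 = ⊥-elim (x≢0 refl)
isZero-nonzero +[1+ m ] _   = refl
isZero-nonzero -[1+ m ] _   = refl

oneZero-nonzeroˡ : ∀ x y → x ≢ 0ℤ → (if oneZero x y then 1 else 0) ≡ isZero y
oneZero-nonzeroˡ +0       y        x≢0 = ⊥-elim (x≢0 refl)
oneZero-nonzeroˡ +[1+ m ] +0       _   = refl
oneZero-nonzeroˡ +[1+ m ] +[1+ n ] _   = refl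
oneZero-nonzeroˡ +[1+ m ] -[1+ n ] _   = refl
oneZero-nonzeroˡ -[1+ m ] +0       _   = refl
oneZero-nonzeroˡ -[1+ m ] +[1+ n ] _   = refl
oneZero-nonzeroˡ -[1+ m ] -[1+ n ] _   = refl

oneZero-nonzeroʳ : ∀ x y → y ≢ 0ℤ → (if oneZero x y then 1 else 0) ≡ isZero x
oneZero-nonzeroʳ x        +0       y≢0 = ⊥-elim (y≢0 refl)
oneZero-nonzeroʳ +0       +[1+ n ] _   = refl
oneZero-nonzeroʳ +0       -[1+ n ] _   = refl
oneZero-nonzeroʳ +[1+ m ] +[1+ n ] _   = refl
oneZero-nonzeroʳ +[1+ m ] -[1+ n ] _   = refl
oneZero-nonzeroʳ -[1+ m ] +[1+ n ] _   = refl
oneZero-nonzeroʳ -[1+ m ] -[1+ n ] _   = refl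

zeroContacts-nonzero : ∀ y w z → All (_≢ 0ℤ) (y ∷ w) → zeroContacts ((y ∷ w) ++ [ z ]) ≡ isZero z
zeroContacts-nonzero y []       z (y≢0 ∷ [])       = trans (+-identityʳ _) (oneZero-nonzeroˡ y z y≢0)
zeroContacts-nonzero y (y′ ∷ w) z (y≢0 ∷ y′≢0 ∷ nz) =
  cong₂ _+_ (trans (oneZero-nonzeroˡ y y′ y≢0) (isZero-nonzero y′ y′≢0))
            (zeroContacts-nonzero y′ w z (y′≢0 ∷ nz))

zeroContacts-extend : ∀ x w z → All (_≢ 0ℤ) w → (z ≢ 0ℤ ⊎ w ≢ []) →
  zeroContacts (x ∷ w ++ [ z ]) ≡ isZero x + isZero z
zeroContacts-extend x []      z _              (inj₁ z≢0) =
  trans (+-identityʳ _) (trans (oneZero-nonzeroʳ x z z≢0)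
    (sym (trans (cong (isZero x +_) (isZero-nonzero z z≢0)) (+-identityʳ _))))
zeroContacts-extend x []      z _              (inj₂ ≢[]) = ⊥-elim (≢[] refl)
zeroContacts-extend x (y ∷ w) z (y≢0 ∷ nz)     _          =
  cong₂ _+_ (oneZero-nonzeroʳ x y y≢0) (zeroContacts-nonzero y w z (y≢0 ∷ nz))

-- Negating the entries after c keeps them alternating in step with their new positions.
splice : List ℤ → ℤ → List ℤ → List ℤ
splice u c v = map shift u ++ c ∷ map negShift v

splice-snoc : ∀ pre a c v → splice (pre ++ [ a ]) c v ≡ map shift pre ++ shift a ∷ c ∷ map negShift v
splice-snoc pre a c v = trans (cong (_++ c ∷ map negShift v) (map-++ shift pre [ a ]))
  (++-assoc (map shift pre) [ shift a ] _)

admissible : ℤ → ℤ → List ℤ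
admissible +[1+ m ] -[1+ n ] = 1ℤ ∷ -1ℤ ∷ []
admissible -[1+ m ] +[1+ n ] = -1ℤ ∷ 1ℤ ∷ []
admissible +0       +[1+ n ] = [ 1ℤ ]
admissible +0       -[1+ n ] = [ -1ℤ ]
admissible +[1+ m ] +0       = [ -1ℤ ]
admissible -[1+ m ] +0       = [ 1ℤ ]
admissible _        _        = []

candidates : ℤ → ℤ → List ℤ → List (List ℤ)
candidates a b r = map (λ c → c ∷ map negShift (b ∷ r)) (admissible a b)

insertAfter : ℤ → List ℤ → List (List ℤ)
insertAfter a []      = []
insertAfter a (b ∷ r) = candidates a b r ++ map (shift b ∷_) (insertAfter b r)

insertions : List ℤ → List (List ℤ)
insertions []      = []
insertions (a ∷ l) = map (shift a ∷_) (insertAfter a l)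

insertAfter-opposite : ∀ C L f j z → genPoly C f ≗ mul1+t² (monomial j) →
  genPoly L f ≗ mulT (D z (monomial j)) →
  genPoly (C ++ L) f ≗ D z (monomial (suc j))
insertAfter-opposite C L f j z C≗ L≗ k = begin
  genPoly (C ++ L) f k                                       ≡⟨ genPoly-++ C L f k ⟩
  genPoly C f k + genPoly L f k                              ≡⟨ ⊕-cong C≗ L≗ k ⟩
  mul1+t² (monomial j) k + mulT (D z (monomial j)) k         ≡⟨ D-leibniz z (monomial j) k ⟨
  D z (mulT (monomial j)) k                                  ≡⟨ D-cong z (monomial-suc j) k ⟨
  D z (monomial (suc j)) k                                   ∎
  where open ≡-Reasoning

insertAfter-oneZero : ∀ C L f j z → genPoly C f ≗ monomial (suc j) → genPoly L f ≗ D z (monomial j) →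
  genPoly (C ++ L) f ≗ D (suc z) (monomial j)
insertAfter-oneZero C L f j z C≗ L≗ k = begin
  genPoly (C ++ L) f k                             ≡⟨ genPoly-++ C L f k ⟩
  genPoly C f k + genPoly L f k                    ≡⟨ +-comm (genPoly C f k) _ ⟩
  genPoly L f k + genPoly C f k                    ≡⟨ ⊕-cong L≗ (λ k → trans (C≗ k) (monomial-suc j k)) k ⟩
  D z (monomial j) k + mulT (monomial j) k         ≡⟨ D-suc z (monomial j) k ⟨
  D (suc z) (monomial j) k                         ∎
  where open ≡-Reasoning

tail-genPoly : ∀ a b r → genPoly (map (shift b ∷_) (insertAfter b r)) (crossings ∘ (shift a ∷_)) ≗
  genPoly (insertAfter b r) (λ y → (if opposite a b then 1 else 0) + crossings (shift b ∷ y))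
tail-genPoly a b r = genPoly-prefix (shift b) (insertAfter b r) (crossings ∘ (shift a ∷_)) _
  (λ y → cong (λ o → (if o then 1 else 0) + _) (opposite-shift a b))

tail-genPoly-opposite : ∀ a b r {q} → opposite a b ≡ true →
  genPoly (insertAfter b r) (crossings ∘ (shift b ∷_)) ≗ q →
  genPoly (map (shift b ∷_) (insertAfter b r)) (crossings ∘ (shift a ∷_)) ≗ mulT q
tail-genPoly-opposite a b r opp ≗q k rewrite tail-genPoly a b r k | opp =
  trans (genPoly-suc (insertAfter b r) _ k) (mulT-cong ≗q k)

tail-genPoly-same : ∀ a b r {q} → opposite a b ≡ false →
  genPoly (insertAfter b r) (crossings ∘ (shift b ∷_)) ≗ q →
  genPoly (map (shift b ∷_) (insertAfter b r)) (crossings ∘ (shift a ∷_)) ≗ q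
tail-genPoly-same a b r same ≗q k rewrite tail-genPoly a b r k | same = ≗q k

insertAfter-genPoly : ∀ a l →
  genPoly (insertAfter a l) (crossings ∘ (shift a ∷_)) ≗ D (zeroContacts (a ∷ l)) (monomial (crossings (a ∷ l)))
insertAfter-genPoly a [] k = sym (D-monomial₀ k)
insertAfter-genPoly a@(+[1+ m ]) (b@(-[1+ n ]) ∷ r) =
  insertAfter-opposite (candidates a b r) _ (crossings ∘ (shift a ∷_)) _ _
    (genPoly-pair (crossings ∘ (shift a ∷_)) (1ℤ ∷ map negShift (b ∷ r)) (-1ℤ ∷ map negShift (b ∷ r))
                  _ (crossings-negShift (b ∷ r)) refl)
    (tail-genPoly-opposite a b r refl (insertAfter-genPoly b r))
insertAfter-genPoly a@(-[1+ m ]) (b@(+[1+ n ]) ∷ r) =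
  insertAfter-opposite (candidates a b r) _ (crossings ∘ (shift a ∷_)) _ _
    (genPoly-pair (crossings ∘ (shift a ∷_)) (-1ℤ ∷ map negShift (b ∷ r)) (1ℤ ∷ map negShift (b ∷ r))
                  _ (crossings-negShift (b ∷ r)) refl)
    (tail-genPoly-opposite a b r refl (insertAfter-genPoly b r))
insertAfter-genPoly a@(+0) (b@(+[1+ n ]) ∷ r) =
  insertAfter-oneZero (candidates a b r) _ (crossings ∘ (shift a ∷_)) _ _
    (genPoly-single (crossings ∘ (shift a ∷_)) (1ℤ ∷ map negShift (b ∷ r))
                    _ (cong suc (crossings-negShift (b ∷ r))))
    (tail-genPoly-same a b r refl (insertAfter-genPoly b r))
insertAfter-genPoly a@(+0) (b@(-[1+ n ]) ∷ r) =
  insertAfter-oneZero (candidates a b r) _ (crossings ∘ (shift a ∷_)) _ _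
    (genPoly-single (crossings ∘ (shift a ∷_)) (-1ℤ ∷ map negShift (b ∷ r))
                    _ (cong suc (crossings-negShift (b ∷ r))))
    (tail-genPoly-same a b r refl (insertAfter-genPoly b r))
insertAfter-genPoly a@(+[1+ m ]) (b@(+0) ∷ r) =
  insertAfter-oneZero (candidates a b r) _ (crossings ∘ (shift a ∷_)) _ _
    (genPoly-single (crossings ∘ (shift a ∷_)) (-1ℤ ∷ map negShift (b ∷ r))
                    _ (cong suc (crossings-negShift (b ∷ r))))
    (tail-genPoly-same a b r refl (insertAfter-genPoly b r))
insertAfter-genPoly a@(-[1+ m ]) (b@(+0) ∷ r) =
  insertAfter-oneZero (candidates a b r) _ (crossings ∘ (shift a ∷_)) _ _
    (genPoly-single (crossings ∘ (shift a ∷_)) (1ℤ ∷ map negShift (b ∷ r))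
                    _ (cong suc (crossings-negShift (b ∷ r))))
    (tail-genPoly-same a b r refl (insertAfter-genPoly b r))
insertAfter-genPoly a@(+0)       (b@(+0) ∷ r)       = tail-genPoly-same a b r refl (insertAfter-genPoly b r)
insertAfter-genPoly a@(+[1+ m ]) (b@(+[1+ n ]) ∷ r) = tail-genPoly-same a b r refl (insertAfter-genPoly b r)
insertAfter-genPoly a@(-[1+ m ]) (b@(-[1+ n ]) ∷ r) = tail-genPoly-same a b r refl (insertAfter-genPoly b r)

insertions-genPoly : ∀ e → genPoly (insertions e) crossings ≗ D (zeroContacts e) (monomial (crossings e))
insertions-genPoly []      k = sym (D-monomial₀ k)
insertions-genPoly (a ∷ l) k = trans (genPoly-map (shift a ∷_) (insertAfter a l) crossings k)
  (insertAfter-genPoly a l k)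

record Insertion (e e′ : List ℤ) : Set where
  constructor insertion
  field
    pre  : List ℤ
    a b  : ℤ
    post : List ℤ
    c    : ℤ
    e≡   : e ≡ pre ++ a ∷ b ∷ post
    c∈   : c ∈ admissible a b
    e′≡  : e′ ≡ splice (pre ++ [ a ]) c (b ∷ post)

insertAfter-Insertion : ∀ a l y → y ∈ insertAfter a l → Insertion (a ∷ l) (shift a ∷ y)
insertAfter-Insertion a (b ∷ r) y y∈ with ∈-++⁻ (candidates a b r) y∈
... | inj₁ y∈C with ∈-map⁻ (λ c → c ∷ map negShift (b ∷ r)) y∈C
...   | c , c∈ , refl = insertion [] a b r c refl c∈ refl
insertAfter-Insertion a (b ∷ r) y y∈ | inj₂ y∈L with ∈-map⁻ (shift b ∷_) y∈L
...   | y′ , y′∈ , refl with insertAfter-Insertion b r y′ y′∈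
...     | insertion pre a′ b′ post c e≡ c∈ e′≡ =
          insertion (a ∷ pre) a′ b′ post c (cong (a ∷_) e≡) c∈ (cong (shift a ∷_) e′≡)

∈insertions⁻ : ∀ e e′ → e′ ∈ insertions e → Insertion e e′
∈insertions⁻ (a ∷ l) e′ e′∈ with ∈-map⁻ (shift a ∷_) e′∈
... | y , y∈ , refl = insertAfter-Insertion a l y y∈

∈insertions⁺ : ∀ pre a b post c → c ∈ admissible a b →
  splice (pre ++ [ a ]) c (b ∷ post) ∈ insertions (pre ++ a ∷ b ∷ post)
∈insertions⁺ []                a b post c c∈ =
  ∈-map⁺ (shift a ∷_) (∈-++⁺ˡ (∈-map⁺ (λ c → c ∷ map negShift (b ∷ post)) c∈))
∈insertions⁺ (p ∷ [])          a b post c c∈ =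
  ∈-map⁺ (shift p ∷_) (∈-++⁺ʳ (candidates p a (b ∷ post)) (∈insertions⁺ [] a b post c c∈))
∈insertions⁺ (p ∷ p′ ∷ pre)    a b post c c∈ =
  ∈-map⁺ (shift p ∷_) (∈-++⁺ʳ (candidates p p′ (pre ++ a ∷ b ∷ post)) (∈insertions⁺ (p′ ∷ pre) a b post c c∈))

admissible-unit : ∀ a b c → c ∈ admissible a b → ∣ c ∣ ≡ 1
admissible-unit +[1+ m ] -[1+ n ] c (here refl)         = refl
admissible-unit +[1+ m ] -[1+ n ] c (there (here refl)) = refl
admissible-unit -[1+ m ] +[1+ n ] c (here refl)         = refl
admissible-unit -[1+ m ] +[1+ n ] c (there (here refl)) = refl
admissible-unit +0       +[1+ n ] c (here refl)         = refl
admissible-unit +0       -[1+ n ] c (here refl)         = refl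
admissible-unit +[1+ m ] +0       c (here refl)         = refl
admissible-unit -[1+ m ] +0       c (here refl)         = refl

admissible-unique : ∀ a b → Unique (admissible a b)
admissible-unique +[1+ m ] -[1+ n ] = ((λ ()) ∷ []) ∷ [] ∷ []
admissible-unique -[1+ m ] +[1+ n ] = ((λ ()) ∷ []) ∷ [] ∷ []
admissible-unique +0       +0       = []
admissible-unique +0       +[1+ n ] = [] ∷ []
admissible-unique +0       -[1+ n ] = [] ∷ []
admissible-unique +[1+ m ] +0       = [] ∷ []
admissible-unique +[1+ m ] +[1+ n ] = []
admissible-unique -[1+ m ] +0       = [] ∷ []
admissible-unique -[1+ m ] -[1+ n ] = []

insertAfter-unique : ∀ a l → Unique (insertAfter a l)
insertAfter-unique a []      = []
insertAfter-unique a (b ∷ r) =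
  UP.++⁺ (UP.map⁺ ∷-injectiveˡ (admissible-unique a b)) (UP.map⁺ ∷-injectiveʳ (insertAfter-unique b r)) disjoint
  where
  disjoint : ∀ {y} → ¬ (y ∈ candidates a b r × y ∈ map (shift b ∷_) (insertAfter b r))
  disjoint (y∈C , y∈L) with ∈-map⁻ (λ c → c ∷ map negShift (b ∷ r)) y∈C | ∈-map⁻ (shift b ∷_) y∈L
  ... | c , c∈ , refl | _ , _ , c∷≡ =
    shift-nonUnit b (trans (cong ∣_∣ (sym (∷-injectiveˡ c∷≡))) (admissible-unit a b c c∈))

insertions-unique : ∀ e → Unique (insertions e)
insertions-unique []      = []
insertions-unique (a ∷ l) = UP.map⁺ ∷-injectiveʳ (insertAfter-unique a l)

-- Shifted entries never have absolute value 1, so the first unit after the head is the inserted one.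
removeUnit : List ℤ → List ℤ
removeUnit (x ∷ y ∷ r) = unshift x ∷ (if ∣ y ∣ ≡ᵇ 1 then map unnegShift r else removeUnit (y ∷ r))
removeUnit l           = l

∣shift∣≡ᵇ1 : ∀ x → (∣ shift x ∣ ≡ᵇ 1) ≡ false
∣shift∣≡ᵇ1 +[1+ m ] = refl
∣shift∣≡ᵇ1 -[1+ m ] = refl
∣shift∣≡ᵇ1 +0       = refl

removeUnit-shift : ∀ x y r → removeUnit (x ∷ shift y ∷ r) ≡ unshift x ∷ removeUnit (shift y ∷ r)
removeUnit-shift x y r rewrite ∣shift∣≡ᵇ1 y = refl

removeUnit-splice : ∀ pre a b post c → ∣ c ∣ ≡ 1 →
  removeUnit (splice (pre ++ [ a ]) c (b ∷ post)) ≡ pre ++ a ∷ b ∷ post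
removeUnit-splice []             a b post c ∣c∣≡1 rewrite ∣c∣≡1 =
  cong₂ _∷_ (unshift-shift a) (map-unnegShift-negShift (b ∷ post))
  where
  map-unnegShift-negShift : ∀ l → map unnegShift (map negShift l) ≡ l
  map-unnegShift-negShift l = trans (sym (map-∘ l))
    (map-id-local (All.tabulate (λ {x} _ → unnegShift-negShift x)))
removeUnit-splice (p ∷ [])       a b post c ∣c∣≡1 =
  trans (removeUnit-shift (shift p) a _) (cong₂ _∷_ (unshift-shift p) (removeUnit-splice [] a b post c ∣c∣≡1))
removeUnit-splice (p ∷ p′ ∷ pre) a b post c ∣c∣≡1 =
  trans (removeUnit-shift (shift p) p′ _)
    (cong₂ _∷_ (unshift-shift p) (removeUnit-splice (p′ ∷ pre) a b post c ∣c∣≡1))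

removeUnit-insertions : ∀ e e′ → e′ ∈ insertions e → removeUnit e′ ≡ e
removeUnit-insertions e e′ e′∈ with ∈insertions⁻ e e′ e′∈
... | insertion pre a b post c refl c∈ refl = removeUnit-splice pre a b post c (admissible-unit a b c c∈)

genPoly-concatMap-insertions : ∀ z L → All (λ e → zeroContacts e ≡ z) L →
  genPoly (concatMap insertions L) crossings ≗ D z (genPoly L crossings)
genPoly-concatMap-insertions z []      []              k = sym (D-const0 z k)
genPoly-concatMap-insertions z (e ∷ L) (zc≡z ∷ zc≡zs) k = begin
  genPoly (insertions e ++ concatMap insertions L) crossings k
    ≡⟨ genPoly-++ (insertions e) _ crossings k ⟩
  genPoly (insertions e) crossings k + genPoly (concatMap insertions L) crossings k
    ≡⟨ ⊕-cong (λ k → trans (insertions-genPoly e k) (cong (λ z → D z _ k) zc≡z))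
              (genPoly-concatMap-insertions z L zc≡zs) k ⟩
  D z (monomial (crossings e)) k + D z (genPoly L crossings) k
    ≡⟨ D-⊕ z _ _ k ⟨
  D z (monomial (crossings e) ⊕ genPoly L crossings) k
    ≡⟨ D-cong z (λ k → sym (genPoly-∷ e L crossings k)) k ⟩
  D z (genPoly (e ∷ L) crossings) k ∎
  where open ≡-Reasoning

fitsBetween : Bool → ℤ → ℤ → ℤ → Bool
fitsBetween d a c b = step d (shift a) c ∧ step (not d) c (negShift b)

admissible-sound : ∀ d a b c → T (step d a b) → c ∈ admissible a b →
  T (fitsBetween d a c b)
admissible-sound true  +0       +[1+ n ] c _ (here refl)         = _
admissible-sound false +0       -[1+ n ] c _ (here refl)         = _
admissible-sound false +[1+ m ] +0       c _ (here refl)         = _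
admissible-sound true  -[1+ m ] +0       c _ (here refl)         = _
admissible-sound false +[1+ m ] -[1+ n ] c _ (here refl)         = _
admissible-sound false +[1+ m ] -[1+ n ] c _ (there (here refl)) = _
admissible-sound true  -[1+ m ] +[1+ n ] c _ (here refl)         = _
admissible-sound true  -[1+ m ] +[1+ n ] c _ (there (here refl)) = _

admissible-complete : ∀ d a b c → ∣ c ∣ ≡ 1 → ¬ (a ≡ 0ℤ × b ≡ 0ℤ) →
  T (fitsBetween d a c b) → T (step d a b) × c ∈ admissible a b
admissible-complete d     a        b        +0           () _ _
admissible-complete d     a        b        +[1+ suc k ] () _ _
admissible-complete d     a        b        -[1+ suc k ] () _ _
admissible-complete true  +0       +0       +[1+ 0 ]     _ ≢00 _ = ⊥-elim (≢00 (refl , refl))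
admissible-complete false +0       +0       -[1+ 0 ]     _ ≢00 _ = ⊥-elim (≢00 (refl , refl))
admissible-complete true  +0       +[1+ n ] +[1+ 0 ]     _ _   _ = _ , here refl
admissible-complete true  -[1+ m ] +0       +[1+ 0 ]     _ _   _ = _ , here refl
admissible-complete true  -[1+ m ] +[1+ n ] +[1+ 0 ]     _ _   _ = _ , there (here refl)
admissible-complete true  -[1+ m ] +[1+ n ] -[1+ 0 ]     _ _   _ = _ , here refl
admissible-complete false +0       -[1+ n ] -[1+ 0 ]     _ _   _ = _ , here refl
admissible-complete false +[1+ m ] +0       -[1+ 0 ]     _ _   _ = _ , here refl
admissible-complete false +[1+ m ] -[1+ n ] +[1+ 0 ]     _ _   _ = _ , here refl
admissible-complete false +[1+ m ] -[1+ n ] -[1+ 0 ]     _ _   _ = _ , there (here refl)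
admissible-complete false +[1+ m ] +0       +[1+ 0 ]     _ _   ()
admissible-complete false +[1+ m ] +[1+ n ] +[1+ 0 ]     _ _   ()
admissible-complete true  +0       +0       -[1+ 0 ]     _ _   ()
admissible-complete true  +0       +[1+ n ] -[1+ 0 ]     _ _   ()
admissible-complete true  +0       -[1+ n ] -[1+ 0 ]     _ _   ()
admissible-complete true  +[1+ m ] +0       -[1+ 0 ]     _ _   ()
admissible-complete true  +[1+ m ] +[1+ n ] -[1+ 0 ]     _ _   ()
admissible-complete true  +[1+ m ] -[1+ n ] -[1+ 0 ]     _ _   ()
admissible-complete true  -[1+ m ] +0       -[1+ 0 ]     _ _   ()
admissible-complete true  -[1+ m ] -[1+ n ] -[1+ 0 ]     _ _   ()

zigzag-spliceTail : ∀ d a c b post → zigzag d (shift a ∷ c ∷ map negShift (b ∷ post)) ≡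
  fitsBetween d a c b ∧ zigzag (not d) (b ∷ post)
zigzag-spliceTail true  a c b post =
  trans (cong (λ z → step true (shift a) c ∧ (step false c (negShift b) ∧ z)) (zigzag-negShift true (b ∷ post)))
        (sym (∧-assoc (step true (shift a) c) _ _))
zigzag-spliceTail false a c b post =
  trans (cong (λ z → step false (shift a) c ∧ (step true c (negShift b) ∧ z)) (zigzag-negShift false (b ∷ post)))
        (sym (∧-assoc (step false (shift a) c) _ _))

zigzag-splice : ∀ d pre a c b post → let d′ = flips (length pre) d in
  zigzag d (splice (pre ++ [ a ]) c (b ∷ post)) ≡
  zigzag d (pre ++ [ a ]) ∧ (fitsBetween d′ a c b ∧ zigzag (not d′) (b ∷ post))
zigzag-splice d pre a c b post = begin
  zigzag d (splice (pre ++ [ a ]) c (b ∷ post))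
    ≡⟨ cong (zigzag d) (splice-snoc pre a c (b ∷ post)) ⟩
  zigzag d (map shift pre ++ shift a ∷ c ∷ map negShift (b ∷ post))
    ≡⟨ zigzag-++ d (map shift pre) (shift a) _ ⟩
  zigzag d (map shift pre ++ [ shift a ]) ∧
  zigzag (flips (length (map shift pre)) d) (shift a ∷ c ∷ map negShift (b ∷ post))
    ≡⟨ cong₂ _∧_ (trans (cong (zigzag d) (sym (map-++ shift pre [ a ]))) (zigzag-shift d (pre ++ [ a ])))
                 (trans (cong (λ m → zigzag (flips m d) (shift a ∷ c ∷ map negShift (b ∷ post)))
                              (length-map shift pre))
                        (zigzag-spliceTail (flips (length pre) d) a c b post)) ⟩
  zigzag d (pre ++ [ a ]) ∧ _
    ∎
  where open ≡-Reasoning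

zigzag-insert : ∀ d pre a b post c → c ∈ admissible a b → T (zigzag d (pre ++ a ∷ b ∷ post)) →
  T (zigzag d (splice (pre ++ [ a ]) c (b ∷ post)))
zigzag-insert d pre a b post c c∈ zz
  with Equivalence.to (T-∧ {zigzag d (pre ++ [ a ])}) (subst T (zigzag-++ d pre a (b ∷ post)) zz)
... | zzPre , zzRest with Equivalence.to (T-∧ {step (flips (length pre) d) a b}) zzRest
...   | ab , zzPost = subst T (sym (zigzag-splice d pre a c b post))
          (Equivalence.from T-∧ (zzPre , Equivalence.from T-∧
            (admissible-sound (flips (length pre) d) a b c ab c∈ , zzPost)))

zigzag-remove : ∀ d pre a b post c → ∣ c ∣ ≡ 1 → ¬ (a ≡ 0ℤ × b ≡ 0ℤ) →
  T (zigzag d (splice (pre ++ [ a ]) c (b ∷ post))) →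
  T (zigzag d (pre ++ a ∷ b ∷ post)) × c ∈ admissible a b
zigzag-remove d pre a b post c ∣c∣≡1 ≢00 zz
  with Equivalence.to (T-∧ {zigzag d (pre ++ [ a ])}) (subst T (zigzag-splice d pre a c b post) zz)
... | zzPre , zzRest
  with Equivalence.to (T-∧ {fitsBetween (flips (length pre) d) a c b}) zzRest
...   | local , zzPost with admissible-complete (flips (length pre) d) a b c ∣c∣≡1 ≢00 local
...     | ab , c∈ = subst T (sym (zigzag-++ d pre a (b ∷ post)))
                      (Equivalence.from T-∧ (zzPre , Equivalence.from T-∧ (ab , zzPost))) , c∈

InRange : ℕ → ℤ → Set
InRange n x = x ≢ 0ℤ × ∣ x ∣ ≤ n

IsSignedPerm : ℕ → List ℤ → Set
IsSignedPerm n w = length w ≡ n × All (InRange n) w × Unique (map ∣_∣ w)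

words⁻ : ∀ m vs w → w ∈ words m vs → length w ≡ m × All (_∈ vs) w
words⁻ zero    vs .[] (here refl) = refl , []
words⁻ (suc m) vs w   w∈ with find (∈-concatMap⁻ (λ x → map (x ∷_) (words m vs)) {xs = vs} w∈)
... | x , x∈ , w∈x∷ with ∈-map⁻ (x ∷_) w∈x∷
...   | w′ , w′∈ , refl with words⁻ m vs w′ w′∈
...     | len , all∈ = cong suc len , x∈ ∷ all∈

words⁺ : ∀ m vs w → length w ≡ m → All (_∈ vs) w → w ∈ words m vs
words⁺ zero    vs []      refl []          = here refl
words⁺ (suc m) vs (x ∷ w) len  (x∈ ∷ all∈) =
  ∈-concatMap⁺ (λ x → map (x ∷_) (words m vs)) {xs = vs}
    (lose x∈ (∈-map⁺ (x ∷_) (words⁺ m vs w (suc-injective len) all∈)))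

words-unique : ∀ m vs → Unique vs → Unique (words m vs)
words-unique zero    vs _     = [] ∷ []
words-unique (suc m) vs uniqV =
  concatMap-unique (λ x → map (x ∷_) (words m vs)) head uniqV
    (λ x → UP.map⁺ ∷-injectiveʳ (words-unique m vs uniqV)) head-∷
  where
  head : List ℤ → ℤ
  head []      = 0ℤ
  head (x ∷ _) = x
  head-∷ : ∀ x w → w ∈ map (x ∷_) (words m vs) → head w ≡ x
  head-∷ x w w∈ with ∈-map⁻ (x ∷_) w∈
  ... | _ , _ , refl = refl

±suc : ℕ → List ℤ
±suc i = +[1+ i ] ∷ -[1+ i ] ∷ []

vals⁻ : ∀ n x → x ∈ vals n → InRange n x
vals⁻ n x x∈ with find (∈-concatMap⁻ ±suc {xs = upTo n} x∈)
... | i , i∈ , here refl         = (λ ()) , ∈-upTo⁻ i∈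
... | i , i∈ , there (here refl) = (λ ()) , ∈-upTo⁻ i∈

vals⁺ : ∀ n x → InRange n x → x ∈ vals n
vals⁺ n +0       (x≢0 , _) = ⊥-elim (x≢0 refl)
vals⁺ n +[1+ i ] (_ , i<n) = ∈-concatMap⁺ ±suc {xs = upTo n} (lose (∈-upTo⁺ i<n) (here refl))
vals⁺ n -[1+ i ] (_ , i<n) = ∈-concatMap⁺ ±suc {xs = upTo n} (lose (∈-upTo⁺ i<n) (there (here refl)))

vals-unique : ∀ n → Unique (vals n)
vals-unique n = concatMap-unique ±suc (λ x → ∣ x ∣ ∸ 1) (UP.upTo⁺ n) (λ i → ((λ ()) ∷ []) ∷ [] ∷ []) ∣∣∸1
  where
  ∣∣∸1 : ∀ i x → x ∈ ±suc i → ∣ x ∣ ∸ 1 ≡ i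
  ∣∣∸1 i x (here refl)         = refl
  ∣∣∸1 i x (there (here refl)) = refl

T-not-any⇒All≢ : ∀ a l → T (not (any (a ≡ᵇ_) l)) → All (a ≢_) l
T-not-any⇒All≢ a []      _ = []
T-not-any⇒All≢ a (x ∷ l) t with a ≡ᵇ x in a≡ᵇx
... | false = (λ { refl → subst T a≡ᵇx (≡⇒≡ᵇ a a refl) }) ∷ T-not-any⇒All≢ a l t

All≢⇒T-not-any : ∀ a l → All (a ≢_) l → T (not (any (a ≡ᵇ_) l))
All≢⇒T-not-any a []      []            = _
All≢⇒T-not-any a (x ∷ l) (a≢x ∷ a≢l) with a ≡ᵇ x in a≡ᵇx
... | true  = a≢x (≡ᵇ⇒≡ a x (subst T (sym a≡ᵇx) _))
... | false = All≢⇒T-not-any a l a≢l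

distinctᵇ⇒Unique : ∀ l → T (distinctᵇ l) → Unique l
distinctᵇ⇒Unique []      _ = []
distinctᵇ⇒Unique (a ∷ l) t with Equivalence.to T-∧ t
... | a∉ , rest = T-not-any⇒All≢ a l a∉ ∷ distinctᵇ⇒Unique l rest

Unique⇒distinctᵇ : ∀ l → Unique l → T (distinctᵇ l)
Unique⇒distinctᵇ []      []             = _
Unique⇒distinctᵇ (a ∷ l) (a∉l ∷ uniqL) =
  Equivalence.from T-∧ (All≢⇒T-not-any a l a∉l , Unique⇒distinctᵇ l uniqL)

∈signedPerms⁻ : ∀ n w → w ∈ signedPerms n → IsSignedPerm n w
∈signedPerms⁻ n w w∈ with ∈-filter⁻ (T? ∘ (distinctᵇ ∘ map ∣_∣)) {xs = words n (vals n)} w∈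
... | w∈words , distinct with words⁻ n (vals n) w w∈words
...   | len , all∈ = len , All.map (vals⁻ n _) all∈ , distinctᵇ⇒Unique _ distinct

∈signedPerms⁺ : ∀ n w → IsSignedPerm n w → w ∈ signedPerms n
∈signedPerms⁺ n w (len , inRange , uniq) =
  ∈-filter⁺ (T? ∘ (distinctᵇ ∘ map ∣_∣)) {xs = words n (vals n)}
    (words⁺ n (vals n) w len (All.map (vals⁺ n _) inRange)) (Unique⇒distinctᵇ _ uniq)

signedPerms-unique : ∀ n → Unique (signedPerms n)
signedPerms-unique n = UP.filter⁺ (T? ∘ (distinctᵇ ∘ map ∣_∣)) (words-unique n (vals n) (vals-unique n))

InRange-shift : ∀ {n} x → InRange n x → InRange (suc n) (shift x)
InRange-shift +0       (x≢0 , _) = ⊥-elim (x≢0 refl)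
InRange-shift +[1+ m ] (_ , m<n) = (λ ()) , s≤s m<n
InRange-shift -[1+ m ] (_ , m<n) = (λ ()) , s≤s m<n

InRange-negShift : ∀ {n} x → InRange n x → InRange (suc n) (negShift x)
InRange-negShift +0       (x≢0 , _) = ⊥-elim (x≢0 refl)
InRange-negShift +[1+ m ] (_ , m<n) = (λ ()) , s≤s m<n
InRange-negShift -[1+ m ] (_ , m<n) = (λ ()) , s≤s m<n

InRange-shift⁻ : ∀ {n} x → InRange (suc n) (shift x) → InRange n x
InRange-shift⁻ +0       (x≢0 , _)       = ⊥-elim (x≢0 refl)
InRange-shift⁻ +[1+ m ] (_ , s≤s m<n) = (λ ()) , m<n
InRange-shift⁻ -[1+ m ] (_ , s≤s m<n) = (λ ()) , m<n

InRange-negShift⁻ : ∀ {n} x → InRange (suc n) (negShift x) → InRange n x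
InRange-negShift⁻ +0       (x≢0 , _)       = ⊥-elim (x≢0 refl)
InRange-negShift⁻ +[1+ m ] (_ , s≤s m<n) = (λ ()) , m<n
InRange-negShift⁻ -[1+ m ] (_ , s≤s m<n) = (λ ()) , m<n

length-splice : ∀ u c v → length (splice u c v) ≡ suc (length (u ++ v))
length-splice []      c v = cong suc (length-map negShift v)
length-splice (x ∷ u) c v = cong suc (length-splice u c v)

∣splice∣ : ∀ u c v → map ∣_∣ (splice u c v) ≡ map shiftℕ (map ∣_∣ u) ++ ∣ c ∣ ∷ map shiftℕ (map ∣_∣ v)
∣splice∣ []      c []      = refl
∣splice∣ []      c (y ∷ v) = cong₂ (λ z zs → ∣ c ∣ ∷ z ∷ zs) (∣negShift∣ y) (∷-injectiveʳ (∣splice∣ [] c v))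
∣splice∣ (x ∷ u) c v       = cong₂ _∷_ (∣shift∣ x) (∣splice∣ u c v)

Unique-shiftℕ-insert : ∀ us vs → Unique (us ++ vs) → Unique (map shiftℕ us ++ 1 ∷ map shiftℕ vs)
Unique-shiftℕ-insert us vs uniq = Unique-insert (map shiftℕ us) (map shiftℕ vs) 1
  (subst Unique (map-++ shiftℕ us vs) (UP.map⁺ shiftℕ-injective uniq))
  (subst (All (1 ≢_)) (map-++ shiftℕ us vs) (AllP.map⁺ (All.tabulate (λ {x} _ → shiftℕ≢1 x ∘ sym))))

Unique-shiftℕ-remove : ∀ us vs → Unique (map shiftℕ us ++ 1 ∷ map shiftℕ vs) → Unique (us ++ vs)
Unique-shiftℕ-remove us vs uniq =
  UP.map⁻ (subst Unique (sym (map-++ shiftℕ us vs))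
    (proj₁ (Unique-remove (map shiftℕ us) (map shiftℕ vs) 1 uniq)))

signedPerm-insert : ∀ n u c v → ∣ c ∣ ≡ 1 → IsSignedPerm n (u ++ v) →
  IsSignedPerm (suc n) (splice u c v)
signedPerm-insert n u c v ∣c∣≡1 (len , inRange , uniq) with AllP.++⁻ u inRange
... | uInRange , vInRange =
    trans (length-splice u c v) (cong suc len)
  , AllP.++⁺ (AllP.map⁺ (All.map (InRange-shift _) uInRange))
             (cInRange ∷ AllP.map⁺ (All.map (InRange-negShift _) vInRange))
  , subst Unique (sym (trans (∣splice∣ u c v) (cong (λ z → _ ++ z ∷ _) ∣c∣≡1)))
      (Unique-shiftℕ-insert (map ∣_∣ u) (map ∣_∣ v) (subst Unique (map-++ ∣_∣ u v) uniq))
  where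
  cInRange : InRange (suc n) c
  cInRange = (λ { refl → case ∣c∣≡1 of λ () }) , subst (_≤ suc n) (sym ∣c∣≡1) (s≤s z≤n)

signedPerm-remove : ∀ n u c v → ∣ c ∣ ≡ 1 → IsSignedPerm (suc n) (splice u c v) →
  IsSignedPerm n (u ++ v)
signedPerm-remove n u c v ∣c∣≡1 (len , inRange , uniq) with AllP.++⁻ (map shift u) inRange
... | uInRange , _ ∷ vInRange =
    suc-injective (trans (sym (length-splice u c v)) len)
  , AllP.++⁺ (All.map (InRange-shift⁻ _) (AllP.map⁻ uInRange))
             (All.map (InRange-negShift⁻ _) (AllP.map⁻ vInRange))
  , subst Unique (sym (map-++ ∣_∣ u v))
      (Unique-shiftℕ-remove (map ∣_∣ u) (map ∣_∣ v)
        (subst Unique (trans (∣splice∣ u c v) (cong (λ z → _ ++ z ∷ _) ∣c∣≡1)) uniq))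

-- Otherwise 0, 1 and the |xᵢ| would be n + 3 distinct numbers below n + 2.
signedPerm-hasUnit : ∀ n w → IsSignedPerm (suc n) w → Any (λ x → ∣ x ∣ ≡ 1) w
signedPerm-hasUnit n w (len , inRange , uniq) with Any.any? (λ x → ∣ x ∣ ℕ.≟ 1) w
... | yes hasUnit = hasUnit
... | no  noUnit  = ⊥-elim (n≮n (suc (suc n)) (subst (λ m → suc (suc m) ≤ suc (suc n)) (trans (length-map ∣_∣ w) len)
                      (unique-length-≤ (suc (suc n)) (0 ∷ 1 ∷ map ∣_∣ w) uniq′ bounded)))
  where
  0∉ : All (0 ≢_) (map ∣_∣ w)
  0∉ = AllP.map⁺ (All.map (λ (x≢0 , _) → x≢0 ∘ ∣i∣≡0⇒i≡0 ∘ sym) inRange)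
  1∉ : All (1 ≢_) (map ∣_∣ w)
  1∉ = AllP.map⁺ (All.map (_∘ sym) (AllP.¬Any⇒All¬ w noUnit))
  uniq′ : Unique (0 ∷ 1 ∷ map ∣_∣ w)
  uniq′ = ((λ ()) ∷ 0∉) ∷ 1∉ ∷ uniq
  bounded : All (_< suc (suc n)) (0 ∷ 1 ∷ map ∣_∣ w)
  bounded = s≤s z≤n ∷ s≤s (s≤s z≤n) ∷ AllP.map⁺ (All.map (λ (_ , ≤1+n) → s≤s ≤1+n) inRange)

signedPerm-unsplice : ∀ n w → IsSignedPerm (suc n) w → ∃ λ u → ∃₂ λ c v → ∣ c ∣ ≡ 1 × w ≡ splice u c v
signedPerm-unsplice n w (len , inRange , uniq) with find (signedPerm-hasUnit n w (len , inRange , uniq))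
... | c , c∈w , ∣c∣≡1 with ∈-∃++ c∈w
...   | u , v , refl = map unshift u , c , map unnegShift v , ∣c∣≡1 ,
          cong₂ (λ p q → p ++ c ∷ q) (sym (map-shift-unshift u uNonUnit))
                                     (sym (map-negShift-unnegShift v vNonUnit))
  where
  others : All (∣ c ∣ ≢_) (map ∣_∣ u ++ map ∣_∣ v)
  others = proj₂ (Unique-remove (map ∣_∣ u) (map ∣_∣ v) ∣ c ∣ (subst Unique (map-++ ∣_∣ u (c ∷ v)) uniq))
  nonUnit : ∀ {l} → All (∣ c ∣ ≢_) (map ∣_∣ l) → All (λ x → ∣ x ∣ ≢ 1) l
  nonUnit ≢c = All.map (λ ∣c∣≢∣x∣ ∣x∣≡1 → ∣c∣≢∣x∣ (trans ∣c∣≡1 (sym ∣x∣≡1))) (AllP.map⁻ ≢c)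
  uNonUnit : All (λ x → ∣ x ∣ ≢ 1) u
  uNonUnit = nonUnit (AllP.++⁻ˡ (map ∣_∣ u) others)
  vNonUnit : All (λ x → ∣ x ∣ ≢ 1) v
  vNonUnit = nonUnit (AllP.++⁻ʳ (map ∣_∣ u) others)
  map-shift-unshift : ∀ l → All (λ x → ∣ x ∣ ≢ 1) l → map shift (map unshift l) ≡ l
  map-shift-unshift l nu = trans (sym (map-∘ l)) (map-id-local (All.map (shift-unshift _) nu))
  map-negShift-unnegShift : ∀ l → All (λ x → ∣ x ∣ ≢ 1) l → map negShift (map unnegShift l) ≡ l
  map-negShift-unnegShift l nu = trans (sym (map-∘ l)) (map-id-local (All.map (negShift-unnegShift _) nu))

split-extend : ∀ {A : Set} (x : A) w z pre a b post → x ∷ w ++ [ z ] ≡ pre ++ a ∷ b ∷ post →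
  ∃₂ λ u v → w ≡ u ++ v × pre ++ [ a ] ≡ x ∷ u × b ∷ post ≡ v ++ [ z ]
split-extend x w       z []                a b post eq with ∷-injective eq
... | refl , w++z≡ = [] , w , refl , refl , sym w++z≡
split-extend x []      z (p ∷ [])          a b post ()
split-extend x []      z (p ∷ q ∷ [])      a b post ()
split-extend x []      z (p ∷ q ∷ r ∷ pre) a b post ()
split-extend x (y ∷ w) z (p ∷ pre)         a b post eq
  with ∷-injectiveˡ eq | split-extend y w z pre a b post (∷-injectiveʳ eq)
... | refl | u , v , refl , pre++a≡ , b∷post≡ = y ∷ u , v , refl , cong (x ∷_) pre++a≡ , b∷post≡

length≢0⇒≢[] : ∀ {A : Set} {w : List A} {n} → length w ≡ n → n ≢ 0 → w ≢ []
length≢0⇒≢[] len n≢0 refl = n≢0 (sym len)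

snoc-view : ∀ {A : Set} (y : A) u → ∃₂ λ pre a → pre ++ [ a ] ≡ y ∷ u × a ∈ y ∷ u
snoc-view y []      = [] , y , refl , here refl
snoc-view y (z ∷ u) with snoc-view z u
... | pre , a , ≡z∷u , a∈ = y ∷ pre , a , cong (y ∷_) ≡z∷u , there a∈

junction : ∀ x u v z → All (_≢ 0ℤ) (u ++ v) → (z ≢ 0ℤ ⊎ u ++ v ≢ []) →
  ∃₂ λ pre a → ∃₂ λ b post → pre ++ [ a ] ≡ x ∷ u × b ∷ post ≡ v ++ [ z ] × ¬ (a ≡ 0ℤ × b ≡ 0ℤ)
junction x []      []      z _       (inj₁ z≢0) = [] , x , z , [] , refl , refl , z≢0 ∘ proj₂
junction x []      []      z _       (inj₂ ≢[]) = ⊥-elim (≢[] refl)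
junction x u       (y ∷ v) z nonzero _ with snoc-view x u
... | pre , a , ≡x∷u , _ = pre , a , y , v ++ [ z ] , ≡x∷u , refl ,
                          All.lookup nonzero (∈-++⁺ʳ u (here refl)) ∘ proj₂
junction x (y ∷ u) []      z nonzero _ with snoc-view y u
... | pre , a , ≡y∷u , a∈ = x ∷ pre , a , z , [] , cong (x ∷_) ≡y∷u , refl ,
                           All.lookup nonzero (∈-++⁺ˡ a∈) ∘ proj₁

-- left n and right n are the boundary values π₀ and πₙ₊₁ of a snake of size n.
module Extension (left right : ℕ → ℤ)
                 (shift-left : ∀ n → shift (left n) ≡ left (suc n))
                 (negShift-right : ∀ n → negShift (right n) ≡ right (suc n)) where

  extend : ℕ → List ℤ → List ℤ
  extend n w = left n ∷ w ++ [ right n ]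

  record ExtendedSnake (n : ℕ) (e : List ℤ) : Set where
    constructor extendedSnake
    field
      word    : List ℤ
      e≡      : e ≡ extend n word
      signed  : IsSignedPerm n word
      zigzags : T (zigzag true e)

  splice-extend : ∀ n u c v → splice (left n ∷ u) c (v ++ [ right n ]) ≡ extend (suc n) (splice u c v)
  splice-extend n u c v = begin
    shift (left n) ∷ map shift u ++ c ∷ map negShift (v ++ [ right n ])
      ≡⟨ cong₂ (λ l r → l ∷ map shift u ++ c ∷ r) (shift-left n)
               (trans (map-++ negShift v [ right n ])
                      (cong (λ r → map negShift v ++ [ r ]) (negShift-right n))) ⟩
    left (suc n) ∷ map shift u ++ c ∷ map negShift v ++ [ right (suc n) ]
      ≡⟨ cong (left (suc n) ∷_) (++-assoc (map shift u) (c ∷ map negShift v) [ right (suc n) ]) ⟨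
    extend (suc n) (splice u c v) ∎
    where open ≡-Reasoning

  splice-junction : ∀ n u c v pre a b post → pre ++ [ a ] ≡ left n ∷ u → b ∷ post ≡ v ++ [ right n ] →
    splice (pre ++ [ a ]) c (b ∷ post) ≡ extend (suc n) (splice u c v)
  splice-junction n u c v pre a b post ≡x∷u ≡v++z =
    trans (cong₂ (λ p q → splice p c q) ≡x∷u ≡v++z) (splice-extend n u c v)

  junction-extend : ∀ n u v pre a b post → pre ++ [ a ] ≡ left n ∷ u → b ∷ post ≡ v ++ [ right n ] →
    pre ++ a ∷ b ∷ post ≡ extend n (u ++ v)
  junction-extend n u v pre a b post ≡x∷u ≡v++z = begin
    pre ++ a ∷ b ∷ post                  ≡⟨ ++-assoc pre [ a ] (b ∷ post) ⟨
    (pre ++ [ a ]) ++ b ∷ post           ≡⟨ cong₂ _++_ ≡x∷u ≡v++z ⟩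
    (left n ∷ u) ++ v ++ [ right n ]     ≡⟨ cong (left n ∷_) (++-assoc u v [ right n ]) ⟨
    extend n (u ++ v)                    ∎
    where open ≡-Reasoning

  insertions-extended : ∀ n e e′ → ExtendedSnake n e → e′ ∈ insertions e → ExtendedSnake (suc n) e′
  insertions-extended n e e′ (extendedSnake w refl signed zz) e′∈ with ∈insertions⁻ e e′ e′∈
  ... | insertion pre a b post c e≡ c∈ refl with split-extend (left n) w (right n) pre a b post e≡
  ...   | u , v , refl , ≡x∷u , ≡v++z =
    extendedSnake (splice u c v) (splice-junction n u c v pre a b post ≡x∷u ≡v++z)
      (signedPerm-insert n u c v (admissible-unit a b c c∈) signed)
      (zigzag-insert true pre a b post c c∈ (subst (T ∘ zigzag true) e≡ zz))

  insertions-extended⁻ : ∀ n e′ → (right n ≢ 0ℤ ⊎ n ≢ 0) → ExtendedSnake (suc n) e′ →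
    ∃ λ e → ExtendedSnake n e × e′ ∈ insertions e
  insertions-extended⁻ n e′ nondegenerate (extendedSnake w′ refl signed′ zz′)
    with signedPerm-unsplice n w′ signed′
  ... | u , c , v , ∣c∣≡1 , refl
    with signedPerm-remove n u c v ∣c∣≡1 signed′
  ... | signed@(len , inRange , _)
    with junction (left n) u v (right n) (All.map proj₁ inRange)
           (Sum.map₂ (length≢0⇒≢[] len) nondegenerate)
  ... | pre , a , b , post , ≡x∷u , ≡v++z , ≢00
    with splice-junction n u c v pre a b post ≡x∷u ≡v++z
  ... | e′≡
    with zigzag-remove true pre a b post c ∣c∣≡1 ≢00 (subst (T ∘ zigzag true) (sym e′≡) zz′)
  ... | zz , c∈ =
    pre ++ a ∷ b ∷ post ,
    extendedSnake (u ++ v) (junction-extend n u v pre a b post ≡x∷u ≡v++z) signed zz ,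
    subst (_∈ insertions (pre ++ a ∷ b ∷ post)) e′≡ (∈insertions⁺ pre a b post c c∈)

  module Family (p : ℕ → List ℤ → Bool)
                (p≡zigzag : ∀ n w → IsSignedPerm n w → p n w ≡ zigzag true (extend n w)) where

    members : ℕ → List (List ℤ)
    members n = filterᵇ (p n) (signedPerms n)

    extended : ℕ → List (List ℤ)
    extended n = map (extend n) (members n)

    extended-unique : ∀ n → Unique (extended n)
    extended-unique n = UP.map⁺ (∷ʳ-injectiveˡ _ _ ∘ ∷-injectiveʳ)
      (UP.filter⁺ (T? ∘ p n) (signedPerms-unique n))

    ∈extended⁻ : ∀ {n e} → e ∈ extended n → ExtendedSnake n e
    ∈extended⁻ {n} e∈ with ∈-map⁻ (extend n) e∈
    ... | w , w∈ , refl with ∈-filter⁻ (T? ∘ p n) {xs = signedPerms n} w∈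
    ...   | w∈perms , pw with ∈signedPerms⁻ n w w∈perms
    ...     | signed = extendedSnake w refl signed (subst T (p≡zigzag n w signed) pw)

    ∈extended⁺ : ∀ {n e} → ExtendedSnake n e → e ∈ extended n
    ∈extended⁺ {n} (extendedSnake w refl signed zz) =
      ∈-map⁺ (extend n) (∈-filter⁺ (T? ∘ p n) {xs = signedPerms n} (∈signedPerms⁺ n w signed)
                          (subst T (sym (p≡zigzag n w signed)) zz))

    extended-recurrence : ∀ n → (right n ≢ 0ℤ ⊎ n ≢ 0) →
      genPoly (extended (suc n)) crossings ≗
      D (isZero (left n) + isZero (right n)) (genPoly (extended n) crossings)
    extended-recurrence n nondegenerate k = begin
      genPoly (extended (suc n)) crossings k
        ≡⟨ genPoly-sameElements crossings (extended-unique (suc n))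
             (concatMap-unique insertions removeUnit (extended-unique n)
                               insertions-unique removeUnit-insertions)
             ⊆insertions insertions⊆ k ⟩
      genPoly (concatMap insertions (extended n)) crossings k
        ≡⟨ genPoly-concatMap-insertions _ (extended n) (All.tabulate (zeroContacts-extended ∘ ∈extended⁻)) k ⟩
      D (isZero (left n) + isZero (right n)) (genPoly (extended n) crossings) k ∎
      where
      open ≡-Reasoning
      ⊆insertions : ∀ {e′} → e′ ∈ extended (suc n) → e′ ∈ concatMap insertions (extended n)
      ⊆insertions e′∈ with insertions-extended⁻ n _ nondegenerate (∈extended⁻ e′∈)
      ... | e , snake , e′∈ins = ∈-concatMap⁺ insertions {xs = extended n} (lose (∈extended⁺ snake) e′∈ins)
      insertions⊆ : ∀ {e′} → e′ ∈ concatMap insertions (extended n) → e′ ∈ extended (suc n)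
      insertions⊆ e′∈ with find (∈-concatMap⁻ insertions {xs = extended n} e′∈)
      ... | e , e∈ , e′∈ins = ∈extended⁺ (insertions-extended n e _ (∈extended⁻ e∈) e′∈ins)
      zeroContacts-extended : ∀ {e} → ExtendedSnake n e → zeroContacts e ≡ isZero (left n) + isZero (right n)
      zeroContacts-extended (extendedSnake w refl (len , inRange , _) _) =
        zeroContacts-extend (left n) w (right n) (All.map proj₁ inRange)
          (Sum.map₂ (length≢0⇒≢[] len) nondegenerate)

    genPoly-members : ∀ n → genPoly (members n) (signChanges ∘ extend n) ≗ genPoly (extended n) crossings
    genPoly-members n k =
      trans (genPoly-cong (members n) (signChanges≡crossings ∘ extend n) k)
        (sym (genPoly-map (extend n) (members n) crossings k))

neg-shift : ∀ x → shift (- x) ≡ - shift x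
neg-shift +[1+ m ] = refl
neg-shift -[1+ m ] = refl
neg-shift +0       = refl

signPow-suc : ∀ m x → signPow (suc m) x ≡ signPow m (- x)
signPow-suc zero          x = refl
signPow-suc (suc zero)    x = sym (neg-involutive x)
signPow-suc (suc (suc m)) x = signPow-suc m x

shift-signPow : ∀ m x → shift (signPow m x) ≡ signPow m (shift x)
shift-signPow zero          x = refl
shift-signPow (suc zero)    x = neg-shift x
shift-signPow (suc (suc m)) x = shift-signPow m x

neg-signPow : ∀ m x → - signPow m x ≡ signPow m (- x)
neg-signPow zero          x = refl
neg-signPow (suc zero)    x = refl
neg-signPow (suc (suc m)) x = neg-signPow m x

∣signPow∣ : ∀ m x → ∣ signPow m x ∣ ≡ ∣ x ∣
∣signPow∣ zero          x = refl
∣signPow∣ (suc zero)    x = ∣-i∣≡∣i∣ x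
∣signPow∣ (suc (suc m)) x = ∣signPow∣ m x

-- The right boundary (-1)ⁿ (n+1) of S_n and S⁰_n.
alternatingBound : ℕ → ℤ
alternatingBound n = signPow n +[1+ n ]

negShift-alternatingBound : ∀ n → negShift (alternatingBound n) ≡ alternatingBound (suc n)
negShift-alternatingBound n =
  trans (cong -_ (shift-signPow n +[1+ n ])) (trans (neg-signPow n _) (sym (signPow-suc n _)))

alternatingBound-nonzero : ∀ n → alternatingBound n ≢ 0ℤ
alternatingBound-nonzero n eq with trans (sym (∣signPow∣ n +[1+ n ])) (cong ∣_∣ eq)
... | ()

≤ᵇ-false : ∀ m n → n < m → (m ℕ.≤ᵇ n) ≡ false
≤ᵇ-false m n n<m with m ℕ.≤ᵇ n in m≤ᵇn
... | false = refl
... | true  = ⊥-elim (<⇒≱ n<m (≤ᵇ⇒≤ m n (subst T (sym m≤ᵇn) _)))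

below : ∀ N x → ∣ x ∣ ≤ N → T (x <ᵇ +[1+ N ])
below N +0       _   = _
below N +[1+ m ] m<N rewrite ≤ᵇ-false (suc N) (suc m) (s≤s m<N) = _
below N -[1+ m ] _   = _

above : ∀ N x → ∣ x ∣ ≤ N → T (-[1+ N ] <ᵇ x)
above N +0       _   = _
above N +[1+ m ] _   = _
above N -[1+ m ] m<N rewrite ≤ᵇ-false N m m<N = _

bound : Bool → ℕ → ℤ
bound true  N = +[1+ N ]
bound false N = -[1+ N ]

step-bound : ∀ d N x → ∣ x ∣ ≤ N → T (step d x (bound d N))
step-bound true  N x = below N x
step-bound false N x = above N x

T⇒∧true : ∀ {b} → T b → (b ∧ true) ≡ true
T⇒∧true {true} _ = refl

-- signPow (length r) (bound d N) is ±(N+1) on the side towards which the last step of a zigzag on x ∷ r goes.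
zigzag-++-bound : ∀ d N x r → All (λ y → ∣ y ∣ ≤ N) (x ∷ r) →
  zigzag d ((x ∷ r) ++ [ signPow (length r) (bound d N) ]) ≡ zigzag d (x ∷ r)
zigzag-++-bound d     N x []      (x≤N ∷ _) = T⇒∧true (step-bound d N x x≤N)
zigzag-++-bound true  N x (y ∷ r) (_ ∷ ≤N)  = cong (step true x y ∧_)
  (trans (cong (λ z → zigzag false ((y ∷ r) ++ [ z ])) (signPow-suc (length r) _))
         (zigzag-++-bound false N y r ≤N))
zigzag-++-bound false N x (y ∷ r) (_ ∷ ≤N)  = cong (step false x y ∧_)
  (trans (cong (λ z → zigzag true ((y ∷ r) ++ [ z ])) (signPow-suc (length r) _))
         (zigzag-++-bound true N y r ≤N))

zigzag-++-zero : ∀ d x r → zigzag d ((x ∷ r) ++ [ 0ℤ ]) ≡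
  zigzag d (x ∷ r) ∧ (signPow (length r) (if d then lastOf (x ∷ r) else - lastOf (x ∷ r)) <ᵇ 0ℤ)
zigzag-++-zero true  x []      = ∧-identityʳ _
zigzag-++-zero false x []      = trans (∧-identityʳ _) (sym (<ᵇ-neg x 0ℤ))
zigzag-++-zero true  x (y ∷ r) = trans (cong (step true x y ∧_)
  (trans (zigzag-++-zero false y r) (cong (λ z → zigzag false (y ∷ r) ∧ (z <ᵇ 0ℤ)) (sym (signPow-suc (length r) _)))))
  (sym (∧-assoc (step true x y) _ _))
zigzag-++-zero false x (y ∷ r) = trans (cong (step false x y ∧_)
  (trans (zigzag-++-zero true y r) (cong (λ z → zigzag true (y ∷ r) ∧ (z <ᵇ 0ℤ))
    (trans (cong (signPow (length r)) (sym (neg-involutive (lastOf (y ∷ r))))) (sym (signPow-suc (length r) _))))))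
  (sym (∧-assoc (step false x y) _ _))

∧-swap : ∀ a b c → (a ∧ (b ∧ c)) ≡ (b ∧ (a ∧ c))
∧-swap true  b     c = refl
∧-swap false true  c = refl
∧-swap false false c = refl

isSnake≡zigzag : ∀ n w → IsSignedPerm n w → isSnake w ≡ zigzag true (-[1+ n ] ∷ w ++ [ alternatingBound n ])
isSnake≡zigzag .0               []      (refl , _)          = refl
isSnake≡zigzag .(suc (length r)) (x ∷ r) (refl , inRange , _) = trans (altDown≡zigzag (x ∷ r)) (sym (cong₂ _∧_
  (Equivalence.to T-≡ (above _ x (proj₂ (All.head inRange))))
  (trans (cong (λ z → zigzag false ((x ∷ r) ++ [ z ])) (signPow-suc (length r) _))
         (zigzag-++-bound false _ x r (All.map proj₂ inRange)))))

isSnake0≡zigzag : ∀ n w → IsSignedPerm n w →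
  (isSnake w ∧ firstPos w) ≡ zigzag true (0ℤ ∷ w ++ [ alternatingBound n ])
isSnake0≡zigzag .0               []      (refl , _)          = refl
isSnake0≡zigzag .(suc (length r)) (x ∷ r) (refl , inRange , _) = trans (∧-comm (isSnake (x ∷ r)) _)
  (cong ((0ℤ <ᵇ x) ∧_) (trans (altDown≡zigzag (x ∷ r)) (sym
    (trans (cong (λ z → zigzag false ((x ∷ r) ++ [ z ])) (signPow-suc (length r) _))
           (zigzag-++-bound false _ x r (All.map proj₂ inRange))))))

isSnake00≡zigzag : ∀ n w → IsSignedPerm n w →
  (isSnake w ∧ firstPos w ∧ (signPow n (lastOf w) <ᵇ 0ℤ)) ≡ zigzag true (0ℤ ∷ w ++ [ 0ℤ ])
isSnake00≡zigzag .0               []      (refl , _) = refl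
isSnake00≡zigzag .(suc (length r)) (x ∷ r) (refl , _) = trans (∧-swap (isSnake (x ∷ r)) (0ℤ <ᵇ x) _)
  (cong ((0ℤ <ᵇ x) ∧_) (trans
    (cong₂ (λ s l → s ∧ (l <ᵇ 0ℤ)) (altDown≡zigzag (x ∷ r)) (signPow-suc (length r) (lastOf (x ∷ r))))
    (sym (zigzag-++-zero false x r))))

module S   = Extension (λ n → -[1+ n ]) alternatingBound (λ _ → refl) negShift-alternatingBound
module S⁰  = Extension (const 0ℤ) alternatingBound (λ _ → refl) negShift-alternatingBound
module S⁰⁰ = Extension (const 0ℤ) (const 0ℤ) (λ _ → refl) (λ _ → refl)

module Snakes   = S.Family (λ _ → isSnake) isSnake≡zigzag
module Snakes0  = S⁰.Family (λ _ w → isSnake w ∧ firstPos w) isSnake0≡zigzag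
module Snakes00 = S⁰⁰.Family (λ n w → isSnake w ∧ firstPos w ∧ (signPow n (lastOf w) <ᵇ 0ℤ)) isSnake00≡zigzag

P≗snakes : ∀ n → P n ≗ genPoly (Snakes.extended n) crossings
P≗snakes = D-recurrence-unique 0 P (λ n → genPoly (Snakes.extended n) crossings)
  base P-recurrence extended-step
  where
  base : P 0 ≗ genPoly (Snakes.extended 0) crossings
  base zero          = refl
  base (suc zero)    = refl
  base (suc (suc k)) = refl
  extended-step : ∀ n → genPoly (Snakes.extended (suc n)) crossings
    ≗ D 0 (genPoly (Snakes.extended n) crossings)
  extended-step n k =
    trans (Snakes.extended-recurrence n (inj₁ (alternatingBound-nonzero n)) k)
          (cong (λ z → D z (genPoly (Snakes.extended n) crossings) k) (isZero-nonzero _ (alternatingBound-nonzero n)))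

Q≗snakes0 : ∀ n → Q n ≗ genPoly (Snakes0.extended n) crossings
Q≗snakes0 = D-recurrence-unique 1 Q (λ n → genPoly (Snakes0.extended n) crossings)
  base Q-recurrence extended-step
  where
  base : Q 0 ≗ genPoly (Snakes0.extended 0) crossings
  base zero    = refl
  base (suc k) = refl
  extended-step : ∀ n → genPoly (Snakes0.extended (suc n)) crossings
    ≗ D 1 (genPoly (Snakes0.extended n) crossings)
  extended-step n k =
    trans (Snakes0.extended-recurrence n (inj₁ (alternatingBound-nonzero n)) k)
          (cong (λ z → D (suc z) (genPoly (Snakes0.extended n) crossings) k)
                (isZero-nonzero _ (alternatingBound-nonzero n)))

-- The extended empty snake 0 0 admits no insertion, so S⁰⁰ obeys the recurrence only from size 1 on.
R≗snakes00 : ∀ n → R n ≗ genPoly (Snakes00.extended (suc n)) crossings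
R≗snakes00 = D-recurrence-unique 2 R (λ n → genPoly (Snakes00.extended (suc n)) crossings)
  base R-recurrence extended-step
  where
  base : R 0 ≗ genPoly (Snakes00.extended 1) crossings
  base zero    = refl
  base (suc k) = refl
  extended-step : ∀ n → genPoly (Snakes00.extended (suc (suc n))) crossings
    ≗ D 2 (genPoly (Snakes00.extended (suc n)) crossings)
  extended-step n = Snakes00.extended-recurrence (suc n) (inj₂ (λ ()))

theorem3p4 : (n k : ℕ) →
    (P n k ≡ genPoly (snakes n) (sch n) k) ×
    (Q n k ≡ genPoly (snakes0 n) (sch0 n) k) ×
    (R n k ≡ genPoly (snakes00 (suc n)) (sch00 (suc n)) k)
theorem3p4 n k =
  trans (P≗snakes n k) (sym (Snakes.genPoly-members n k)) ,
  trans (Q≗snakes0 n k) (sym (Snakes0.genPoly-members n k)) ,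
  trans (R≗snakes00 n k) (sym (Snakes00.genPoly-members (suc n) k))
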